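{- Let $m,n\ge1$ be integers, let $K_{1,m}$ be the star with $m$ leaves, $K_n$ the complete graph on $n$ vertices, and $\phi$ any $\mathrm{Aut}(K_n)$-voltage assignment of $K_{1,m}$. Then $$\begin{aligned}F_{K_{1,m}\times^\phi K_n}(\lambda,\mu)=\;&[\lambda+n\mu-(n-1)]^{m-1}\bigl\{[\lambda+n\mu-(n-1)][\lambda+(m+n-1)\mu-(n-1)]-m\bigr\}\\&\times[\lambda+n\mu+1]^{(m-1)(n-1)}\bigl\{[\lambda+n\mu+1][\lambda+(m+n-1)\mu+1]-m\bigr\}^{n-1}.\end{aligned}$$
   Context: For a graph $X$, $F_X(\lambda,\mu)=\det(\lambda I-(A(X)-\mu\mathcal{D}(X)))$, with $A(X)$ the adjacency matrix and $\mathcal{D}(X)$ the diagonal degree matrix. A voltage assignment is $\phi:E(\vec G)\to\mathrm{Aut}(F)$ with $\phi(e^{ -1})=\phi(e)^{ -1}$, where $\vec G$ replaces each edge of $G$ by two opposite directed edges; the graph bundle $G\times^\phi F$ has vertex set $V(G)\times V(F)$ with $(u_1,v_1)\sim(u_2,v_2)$ iff either $u_1u_2\in E(\vec G)$ and $v_2=\phi(u_1u_2)(v_1)$, or $u_1=u_2$ and $v_1v_2\in E(F)$. (When $\phi$ is trivial this is the Cartesian product $K_{1,m}\times K_n$.) -}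

module Defs where

open import Level using (Level)
open import Data.Nat using (ℕ; zero; suc)
import Data.Nat as ℕ
open import Data.Fin using (Fin; zero; suc; punchIn; _≟_; remQuot)
open import Data.Fin.Permutation using (Permutation′; _⟨$⟩ʳ_; _⟨$⟩ˡ_)
open import Data.Bool using (Bool; true; false; _∧_; _∨_; not)
open import Data.Product using (_,_)
open import Relation.Nullary.Decidable using (⌊_⌋; Dec)
open import Relation.Binary.PropositionalEquality using (_≡_)
open import Algebra.Bundles using (CommutativeRing)

record Graph : Set where
  field
    nV  : ℕ
    adj : Fin nV → Fin nV → Bool
open Graph public

star : ℕ → Graph
star m = record { nV = suc m ; adj = a }
  where
  a : Fin (suc m) → Fin (suc m) → Bool
  a zero    zero    = false
  a zero    (suc _) = true
  a (suc _) zero    = true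
  a (suc _) (suc _) = false

complete : ℕ → Graph
complete n = record { nV = n ; adj = λ i j → not ⌊ i ≟ j ⌋ }

-- A voltage assignment on G with values in Aut(F) is a map from the
-- directed edges (u₁,u₂) of G⃗ (i.e. adj G u₁ u₂ ≡ true) to
-- automorphisms of F.  We represent it by a function on all ordered
-- pairs of vertices with values in permutations of V(F); only its
-- values on directed edges matter (the bundle below only looks at those),
-- and the conditions are imposed only on directed edges.

Voltage : Graph → Graph → Set
Voltage G F = Fin (nV G) → Fin (nV G) → Permutation′ (nV F)

record IsVoltageAssignment (G F : Graph) (φ : Voltage G F) : Set where
  field
    isAut : ∀ u₁ u₂ → adj G u₁ u₂ ≡ true →
            ∀ v w → adj F (φ u₁ u₂ ⟨$⟩ʳ v) (φ u₁ u₂ ⟨$⟩ʳ w) ≡ adj F v w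
    inv   : ∀ u₁ u₂ → adj G u₁ u₂ ≡ true →
            ∀ v → φ u₂ u₁ ⟨$⟩ʳ v ≡ φ u₁ u₂ ⟨$⟩ˡ v

bundle : (G F : Graph) → Voltage G F → Graph
bundle G F φ = record { nV = nV G ℕ.* nV F ; adj = a }
  where
  a : Fin (nV G ℕ.* nV F) → Fin (nV G ℕ.* nV F) → Bool
  a p q with remQuot (nV F) p | remQuot (nV F) q
  ... | u₁ , v₁ | u₂ , v₂ =
    (adj G u₁ u₂ ∧ ⌊ v₂ ≟ (φ u₁ u₂ ⟨$⟩ʳ v₁) ⌋) ∨ (⌊ u₁ ≟ u₂ ⌋ ∧ adj F v₁ v₂)

module _ {c ℓ : Level} (R : CommutativeRing c ℓ) where
  open CommutativeRing R hiding (zero)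

  Matrix : ℕ → Set c
  Matrix k = Fin k → Fin k → Carrier

  sumF : ∀ k → (Fin k → Carrier) → Carrier
  sumF zero    f = 0#
  sumF (suc k) f = f zero + sumF k (λ i → f (suc i))

  altSum : ∀ k → (Fin k → Carrier) → Carrier
  altSum zero    f = 0#
  altSum (suc k) f = f zero + - altSum k (λ i → f (suc i))

  det : ∀ k → Matrix k → Carrier
  det zero    M = 1#
  det (suc k) M =
    altSum (suc k) (λ j → M zero j * det k (λ a b → M (suc a) (punchIn j b)))

  boolR : Bool → Carrier
  boolR true  = 1#
  boolR false = 0#

  natR : ℕ → Carrier
  natR zero    = 0#
  natR (suc n) = 1# + natR n

  _^R_ : Carrier → ℕ → Carrier
  x ^R zero  = 1#
  x ^R suc n = x * (x ^R n)

  _-R_ : Carrier → Carrier → Carrier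
  x -R y = x + - y

  adjMat : (X : Graph) → Matrix (nV X)
  adjMat X i j = boolR (adj X i j)

  degR : (X : Graph) → Fin (nV X) → Carrier
  degR X i = sumF (nV X) (λ j → boolR (adj X i j))

  charMat : (X : Graph) → Carrier → Carrier → Matrix (nV X)
  charMat X lam mu i j =
    (if⌊ i ≟ j ⌋ lam) -R (adjMat X i j -R (if⌊ i ≟ j ⌋ (mu * degR X i)))
    where
    if⌊_⌋ : {P : Set} → Dec P → Carrier → Carrier
    if⌊ d ⌋ x = boolR ⌊ d ⌋ * x

  F : (X : Graph) → Carrier → Carrier → Carrier
  F X lam mu = det (nV X) (charMat X lam mu)

-- The star is a tree, so every voltage assignment on it is trivial up to relabelling: renumbering
-- the fibre over each leaf i by φ(centre, i)⁻¹ identifies the bundle with K_{1,m} × K_n. Ordering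
-- the vertices fibre by fibre, λI − (A − μD) becomes I_n ⊗ S − J_n ⊗ I_{m+1}, where S is the
-- arrowhead matrix with diagonal (λ + (m+n−1)μ + 1, λ + nμ + 1, …, λ + nμ + 1) and −1 elsewhere in
-- its first row and column. Adding all block rows to the first and then subtracting the first
-- block column from the others leaves a block triangular matrix, so the determinant is
-- det(S − nI) · det(S)^(n−1). Finally, expanding in the second column gives D(m+1) = q D(m) − q^m
-- for the arrowhead determinant D(m) of order m + 1 with corner p and diagonal q, whence
-- D(m) = q^(m−1)(qp − m).

module Submission where

open import Defs
open import Level using (Level)
open import Data.Nat using (ℕ; zero; suc; _≤_; _∸_; s≤s; z≤n)
import Data.Nat as ℕ
import Data.Nat.Properties as ℕ
open import Data.Integer as ℤ using (ℤ; +_; -[1+_]; _⊖_)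
import Data.Integer.Properties as ℤ
open import Data.Sign as Sign using (Sign)
open import Data.Fin using (Fin; zero; suc; punchIn; punchOut; toℕ; _↑ˡ_; _↑ʳ_; combine; remQuot)
import Data.Fin as Fin
import Data.Fin.Properties as Fin
import Data.Fin.Permutation as Perm
open import Data.Fin.Permutation using (Permutation′; _⟨$⟩ʳ_; _⟨$⟩ˡ_; inverseˡ; inverseʳ; permutation)
open import Data.Fin.Permutation.Components using (transpose)
open import Data.Fin.Permutation.Transposition.List using (TranspositionList; eval; decompose; eval-decompose)
open import Data.List using ([]; _∷_)
open import Data.Bool using (Bool; true; false; _∧_; _∨_; not)
open import Data.Bool.Properties using (not-injective)
open import Data.Maybe using (Maybe; just; nothing)
open import Data.Product using (_×_; _,_; proj₁; proj₂; uncurry)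
open import Data.Sum using (_⊎_; inj₁; inj₂)
open import Data.Empty using (⊥-elim)
open import Function using (_∘_)
open import Relation.Nullary using (yes; no; Dec)
open import Relation.Binary.Definitions using (tri<; tri≈; tri>)
open import Relation.Nullary.Decidable using (⌊_⌋)
open import Relation.Binary.PropositionalEquality as ≡ using (_≡_; _≢_)
open import Algebra.Bundles using (CommutativeRing)
import Algebra.Solver.Ring.AlmostCommutativeRing as ACR

transpose-i : ∀ {n} (i j : Fin n) → transpose i j i ≡ j
transpose-i i j with i Fin.≟ i
... | yes _ = ≡.refl
... | no i≢i = ⊥-elim (i≢i ≡.refl)

transpose-j : ∀ {n} {i j : Fin n} → i ≢ j → transpose i j j ≡ i
transpose-j {i = i} {j} i≢j with j Fin.≟ i
... | yes j≡i = ⊥-elim (i≢j (≡.sym j≡i))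
... | no _ with j Fin.≟ j
...   | yes _ = ≡.refl
...   | no j≢j = ⊥-elim (j≢j ≡.refl)

transpose-≢ : ∀ {n} {i j k : Fin n} → k ≢ i → k ≢ j → transpose i j k ≡ k
transpose-≢ {i = i} {j} {k} k≢i k≢j with k Fin.≟ i
... | yes k≡i = ⊥-elim (k≢i k≡i)
... | no _ with k Fin.≟ j
...   | yes k≡j = ⊥-elim (k≢j k≡j)
...   | no _ = ≡.refl

transpose-ii : ∀ {n} (i k : Fin n) → transpose i i k ≡ k
transpose-ii i k with k Fin.≟ i
... | yes k≡i = ≡.sym k≡i
... | no _ with k Fin.≟ i
...   | yes k≡i = ≡.sym k≡i
...   | no _ = ≡.refl

Consecutive : ∀ {n} → Fin n → Fin n → Set
Consecutive i j = toℕ j ≡ suc (toℕ i)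

Consecutive⇒≢ : ∀ {n} {i j : Fin n} → Consecutive i j → i ≢ j
Consecutive⇒≢ i⋖i ≡.refl = ℕ.1+n≢n (≡.sym i⋖i)

punchIn-consecutive : ∀ {k} {i j : Fin (suc k)} → Consecutive i j → ∀ b →
  punchIn i b ≡ punchIn j b ⊎ (punchIn i b ≡ j × punchIn j b ≡ i)
punchIn-consecutive {i = zero} {zero} () b
punchIn-consecutive {i = zero} {suc zero} _ zero = inj₂ (≡.refl , ≡.refl)
punchIn-consecutive {i = zero} {suc zero} _ (suc b) = inj₁ ≡.refl
punchIn-consecutive {i = zero} {suc (suc j)} () b
punchIn-consecutive {i = suc i} {zero} () b
punchIn-consecutive {suc k} {suc i} {suc j} _ zero = inj₁ ≡.refl
punchIn-consecutive {suc k} {suc i} {suc j} i⋖j (suc b)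
  with punchIn-consecutive {i = i} {j} (ℕ.suc-injective i⋖j) b
... | inj₁ eq = inj₁ (≡.cong suc eq)
... | inj₂ (eqᵢ , eqⱼ) = inj₂ (≡.cong suc eqᵢ , ≡.cong suc eqⱼ)

punchOut-consecutive : ∀ {k} {c i j : Fin (suc k)} → Consecutive i j →
  (c≢i : c ≢ i) (c≢j : c ≢ j) → Consecutive (punchOut c≢i) (punchOut c≢j)
punchOut-consecutive {c = zero} {zero} _ c≢i _ = ⊥-elim (c≢i ≡.refl)
punchOut-consecutive {c = zero} {suc i} {zero} () _ _
punchOut-consecutive {c = zero} {suc i} {suc j} i⋖j _ _ = ℕ.suc-injective i⋖j
punchOut-consecutive {suc k} {suc c} {zero} {zero} () _ _
punchOut-consecutive {suc k} {suc zero} {zero} {suc zero} _ _ c≢j = ⊥-elim (c≢j ≡.refl)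
punchOut-consecutive {suc (suc k)} {suc (suc c)} {zero} {suc zero} _ _ _ = ≡.refl
punchOut-consecutive {suc zero} {suc (suc ())} {zero} {suc zero} _ _ _
punchOut-consecutive {suc k} {suc c} {zero} {suc (suc j)} () _ _
punchOut-consecutive {suc k} {suc c} {suc i} {zero} () _ _
punchOut-consecutive {suc k} {suc c} {suc i} {suc j} i⋖j c≢i c≢j =
  ≡.cong suc (punchOut-consecutive (ℕ.suc-injective i⋖j) (c≢i ∘ ≡.cong suc) (c≢j ∘ ≡.cong suc))

transpose-punchIn : ∀ {k} {c i j : Fin (suc k)} (c≢i : c ≢ i) (c≢j : c ≢ j) (b : Fin k) →
  transpose i j (punchIn c b) ≡ punchIn c (transpose (punchOut c≢i) (punchOut c≢j) b)
transpose-punchIn {k} {c} {i} {j} c≢i c≢j b = go (b Fin.≟ i′) (b Fin.≟ j′)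
  where
  i′ j′ : Fin k
  i′ = punchOut c≢i
  j′ = punchOut c≢j
  ↑i : punchIn c i′ ≡ i
  ↑i = Fin.punchIn-punchOut c≢i
  ↑j : punchIn c j′ ≡ j
  ↑j = Fin.punchIn-punchOut c≢j
  go : Dec (b ≡ i′) → Dec (b ≡ j′) → transpose i j (punchIn c b) ≡ punchIn c (transpose i′ j′ b)
  go (yes ≡.refl) _ = begin
    transpose i j (punchIn c i′) ≡⟨ ≡.cong (transpose i j) ↑i ⟩
    transpose i j i             ≡⟨ transpose-i i j ⟩
    j                           ≡⟨ ≡.sym ↑j ⟩
    punchIn c j′                ≡⟨ ≡.cong (punchIn c) (transpose-i i′ j′) ⟨
    punchIn c (transpose i′ j′ i′) ∎
    where open ≡.≡-Reasoning
  go (no b≢i′) (yes ≡.refl) = begin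
    transpose i j (punchIn c j′) ≡⟨ ≡.cong (transpose i j) ↑j ⟩
    transpose i j j             ≡⟨ transpose-j i≢j ⟩
    i                           ≡⟨ ≡.sym ↑i ⟩
    punchIn c i′                ≡⟨ ≡.cong (punchIn c) (transpose-j (b≢i′ ∘ ≡.sym)) ⟨
    punchIn c (transpose i′ j′ j′) ∎
    where
    open ≡.≡-Reasoning
    i≢j : i ≢ j
    i≢j i≡j = b≢i′ (Fin.punchIn-injective c _ _ (≡.trans ↑j (≡.trans (≡.sym i≡j) (≡.sym ↑i))))
  go (no b≢i′) (no b≢j′) =
    ≡.trans (transpose-≢ (b≢i′ ∘ unpunch ↑i) (b≢j′ ∘ unpunch ↑j))
            (≡.cong (punchIn c) (≡.sym (transpose-≢ b≢i′ b≢j′)))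
    where
    unpunch : ∀ {x y} → punchIn c x ≡ y → punchIn c b ≡ y → b ≡ x
    unpunch ↑x eq = Fin.punchIn-injective c _ _ (≡.trans eq (≡.sym ↑x))

transpose-punchInˡ : ∀ {k} {i j : Fin (suc k)} → Consecutive i j → ∀ b →
  transpose i j (punchIn i b) ≡ punchIn j b
transpose-punchInˡ {i = i} {j} i⋖j b with punchIn-consecutive i⋖j b
... | inj₁ eq = ≡.trans (transpose-≢ (Fin.punchInᵢ≢i i b) (Fin.punchInᵢ≢i j b ∘ ≡.trans (≡.sym eq))) eq
... | inj₂ (eqᵢ , eqⱼ) = ≡.trans (≡.cong (transpose i j) eqᵢ) (≡.trans (transpose-j (Consecutive⇒≢ i⋖j)) (≡.sym eqⱼ))

transpose-punchInʳ : ∀ {k} {i j : Fin (suc k)} → Consecutive i j → ∀ b →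
  transpose i j (punchIn j b) ≡ punchIn i b
transpose-punchInʳ {i = i} {j} i⋖j b with punchIn-consecutive i⋖j b
... | inj₁ eq = ≡.trans (transpose-≢ (Fin.punchInᵢ≢i i b ∘ ≡.trans eq) (Fin.punchInᵢ≢i j b)) (≡.sym eq)
... | inj₂ (eqᵢ , eqⱼ) = ≡.trans (≡.cong (transpose i j) eqⱼ) (≡.trans (transpose-i i j) (≡.sym eqᵢ))

punchIn-↑ˡ : ∀ {s t} (c : Fin (suc s)) (b : Fin s) → punchIn (c ↑ˡ t) (b ↑ˡ t) ≡ punchIn c b ↑ˡ t
punchIn-↑ˡ zero b = ≡.refl
punchIn-↑ˡ (suc c) zero = ≡.refl
punchIn-↑ˡ (suc c) (suc b) = ≡.cong suc (punchIn-↑ˡ c b)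

punchIn-↑ʳ : ∀ {s t} (c : Fin (suc s)) (b : Fin t) → punchIn (c ↑ˡ t) (s ↑ʳ b) ≡ suc s ↑ʳ b
punchIn-↑ʳ zero b = ≡.refl
punchIn-↑ʳ {suc s} (suc c) b = ≡.cong suc (punchIn-↑ʳ c b)

swap01 : ∀ {m} → Fin (suc (suc m)) → Fin (suc (suc m))
swap01 zero = suc zero
swap01 (suc zero) = zero
swap01 (suc (suc x)) = suc (suc x)

swap01-involutive : ∀ {m} (x : Fin (suc (suc m))) → swap01 (swap01 x) ≡ x
swap01-involutive zero = ≡.refl
swap01-involutive (suc zero) = ≡.refl
swap01-involutive (suc (suc x)) = ≡.refl

∀-combine : ∀ {p m n} {P : Fin (m ℕ.* n) → Set p} → (∀ u w → P (combine u w)) → ∀ r → P r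
∀-combine {m = m} {n} {P} P-combine r =
  ≡.subst P (Fin.combine-remQuot {m} n r) (P-combine (proj₁ (remQuot {m} n r)) (proj₂ (remQuot {m} n r)))

module IntegerCoefficients {c ℓ : Level} (R : CommutativeRing c ℓ) where
  open CommutativeRing R
  open import Algebra.Properties.Ring ring using (-‿distribˡ-*; -‿involutive; -‿+-comm; -0#≈0#)
  open import Algebra.Properties.Semiring.Mult.TCOptimised semiring using (×-homo-+; ×1-homo-*) renaming (_×_ to _×′_)
  open import Relation.Binary.Reasoning.Setoid setoid

  -- With the optimised multiple ×′, 1 ×′ 1# reduces to 1#, so the solver constant con (+ 1) is literally 1#.
  fromℤ : ℤ → Carrier
  fromℤ (+ n)    = n ×′ 1#
  fromℤ -[1+ n ] = - (suc n ×′ 1#)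

  private
    sgn : Sign → Carrier
    sgn Sign.+ = 1#
    sgn Sign.- = - 1#

    -1*x≈-x : ∀ x → - 1# * x ≈ - x
    -1*x≈-x x = trans (sym (-‿distribˡ-* 1# x)) (-‿cong (*-identityˡ x))

    fromℤ-⊖ : ∀ m n → fromℤ (m ⊖ n) ≈ m ×′ 1# - n ×′ 1#
    fromℤ-⊖ zero zero = sym (-‿inverseʳ 0#)
    fromℤ-⊖ (suc m) zero = sym (trans (+-congˡ -0#≈0#) (+-identityʳ _))
    fromℤ-⊖ zero (suc n) = sym (+-identityˡ _)
    fromℤ-⊖ (suc m) (suc n) = begin
      fromℤ (suc m ⊖ suc n)              ≡⟨ ≡.cong fromℤ (ℤ.[1+m]⊖[1+n]≡m⊖n m n) ⟩
      fromℤ (m ⊖ n)                      ≈⟨ fromℤ-⊖ m n ⟩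
      m ×′ 1# - n ×′ 1#                  ≈⟨ 1+x-[1+y]≈x-y (m ×′ 1#) (n ×′ 1#) ⟨
      (1# + m ×′ 1#) - (1# + n ×′ 1#)    ≈⟨ +-cong (×-homo-+ 1# 1 m) (-‿cong (×-homo-+ 1# 1 n)) ⟨
      suc m ×′ 1# - suc n ×′ 1#          ∎
      where
      1+x-[1+y]≈x-y : ∀ x y → (1# + x) - (1# + y) ≈ x - y
      1+x-[1+y]≈x-y x y = begin
        (1# + x) + - (1# + y)    ≈⟨ +-cong (+-comm x 1#) (-‿+-comm 1# y) ⟨
        (x + 1#) + (- 1# + - y)  ≈⟨ +-assoc x 1# _ ⟩
        x + (1# + (- 1# + - y))  ≈⟨ +-congˡ (+-assoc 1# (- 1#) (- y)) ⟨
        x + ((1# - 1#) + - y)    ≈⟨ +-congˡ (+-congʳ (-‿inverseʳ 1#)) ⟩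
        x + (0# + - y)           ≈⟨ +-congˡ (+-identityˡ (- y)) ⟩
        x - y                    ∎

    fromℤ-+ : ∀ i j → fromℤ (i ℤ.+ j) ≈ fromℤ i + fromℤ j
    fromℤ-+ -[1+ m ] -[1+ n ] = begin
      - (suc (suc (m ℕ.+ n)) ×′ 1#)       ≡⟨ ≡.cong (λ k → - (suc k ×′ 1#)) (ℕ.+-suc m n) ⟨
      - ((suc m ℕ.+ suc n) ×′ 1#)         ≈⟨ -‿cong (×-homo-+ 1# (suc m) (suc n)) ⟩
      - (suc m ×′ 1# + suc n ×′ 1#)        ≈⟨ -‿+-comm _ _ ⟨
      - (suc m ×′ 1#) + - (suc n ×′ 1#)    ∎
    fromℤ-+ -[1+ m ] (+ n) = trans (fromℤ-⊖ n (suc m)) (+-comm _ _)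
    fromℤ-+ (+ m) -[1+ n ] = fromℤ-⊖ m (suc n)
    fromℤ-+ (+ m) (+ n) = ×-homo-+ 1# m n

    fromℤ-◃ : ∀ s n → fromℤ (s ℤ.◃ n) ≈ sgn s * n ×′ 1#
    fromℤ-◃ s zero = sym (zeroʳ _)
    fromℤ-◃ Sign.+ (suc n) = sym (*-identityˡ _)
    fromℤ-◃ Sign.- (suc n) = sym (-1*x≈-x _)

    fromℤ-signAbs : ∀ i → fromℤ i ≈ sgn (ℤ.sign i) * ℤ.∣ i ∣ ×′ 1#
    fromℤ-signAbs (+ n) = sym (*-identityˡ _)
    fromℤ-signAbs -[1+ n ] = sym (-1*x≈-x _)

    sgn-* : ∀ s t → sgn (s Sign.* t) ≈ sgn s * sgn t
    sgn-* Sign.+ t = sym (*-identityˡ _)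
    sgn-* Sign.- Sign.+ = sym (*-identityʳ _)
    sgn-* Sign.- Sign.- = sym (trans (-1*x≈-x (- 1#)) (-‿involutive 1#))

    fromℤ-* : ∀ i j → fromℤ (i ℤ.* j) ≈ fromℤ i * fromℤ j
    fromℤ-* i j = begin
      fromℤ (i ℤ.* j)
        ≈⟨ fromℤ-◃ (ℤ.sign i Sign.* ℤ.sign j) (ℤ.∣ i ∣ ℕ.* ℤ.∣ j ∣) ⟩
      sgn (ℤ.sign i Sign.* ℤ.sign j) * (ℤ.∣ i ∣ ℕ.* ℤ.∣ j ∣) ×′ 1#
        ≈⟨ *-cong (sgn-* (ℤ.sign i) (ℤ.sign j)) (×1-homo-* ℤ.∣ i ∣ ℤ.∣ j ∣) ⟩
      (sgn (ℤ.sign i) * sgn (ℤ.sign j)) * (ℤ.∣ i ∣ ×′ 1# * ℤ.∣ j ∣ ×′ 1#)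
        ≈⟨ *-assoc _ _ _ ⟩
      sgn (ℤ.sign i) * (sgn (ℤ.sign j) * (ℤ.∣ i ∣ ×′ 1# * ℤ.∣ j ∣ ×′ 1#))
        ≈⟨ *-congˡ (x*[y*z]≈y*[x*z] _ _ _) ⟩
      sgn (ℤ.sign i) * (ℤ.∣ i ∣ ×′ 1# * (sgn (ℤ.sign j) * ℤ.∣ j ∣ ×′ 1#))
        ≈⟨ *-assoc _ _ _ ⟨
      (sgn (ℤ.sign i) * ℤ.∣ i ∣ ×′ 1#) * (sgn (ℤ.sign j) * ℤ.∣ j ∣ ×′ 1#)
        ≈⟨ *-cong (fromℤ-signAbs i) (fromℤ-signAbs j) ⟨
      fromℤ i * fromℤ j ∎
      where
      x*[y*z]≈y*[x*z] : ∀ x y z → x * (y * z) ≈ y * (x * z)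
      x*[y*z]≈y*[x*z] x y z = trans (sym (*-assoc x y z)) (trans (*-congʳ (*-comm x y)) (*-assoc y x z))

    fromℤ-neg : ∀ i → fromℤ (ℤ.- i) ≈ - fromℤ i
    fromℤ-neg -[1+ n ] = sym (-‿involutive _)
    fromℤ-neg (+ zero) = sym -0#≈0#
    fromℤ-neg (+ suc n) = refl

    homomorphism : ACR._-Raw-AlmostCommutative⟶_ ℤ.+-*-rawRing (ACR.fromCommutativeRing R)
    homomorphism = record
      { ⟦_⟧    = fromℤ
      ; +-homo = fromℤ-+
      ; *-homo = fromℤ-*
      ; -‿homo = fromℤ-neg
      ; 0-homo = refl
      ; 1-homo = refl
      }

    fromℤ-≟ : ∀ i j → Maybe (fromℤ i ≈ fromℤ j)
    fromℤ-≟ i j with i ℤ.≟ j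
    ... | yes ≡.refl = just refl
    ... | no _ = nothing

  open import Algebra.Solver.Ring ℤ.+-*-rawRing (ACR.fromCommutativeRing R) homomorphism fromℤ-≟ public
    using (solve; _:=_; _:+_; _:*_; :-_; _:-_; con)

module _ {c ℓ : Level} (R : CommutativeRing c ℓ) where
  open CommutativeRing R hiding (zero)
  open import Algebra.Properties.Ring ring using (-0#≈0#; -‿involutive; -‿distribˡ-*; -‿distribʳ-*; -‿+-comm)
  open import Relation.Binary.Reasoning.Setoid setoid
  open IntegerCoefficients R
  open import Algebra.Properties.CommutativeSemiring.Exp commutativeSemiring using (_^_; ^-congˡ; ^-distrib-*; ^-assocʳ)

  sumF-cong : ∀ k {f g : Fin k → Carrier} → (∀ i → f i ≈ g i) → sumF R k f ≈ sumF R k g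
  sumF-cong zero f≈g = refl
  sumF-cong (suc k) f≈g = +-cong (f≈g zero) (sumF-cong k (f≈g ∘ suc))

  sumF-zero : ∀ k {f : Fin k → Carrier} → (∀ i → f i ≈ 0#) → sumF R k f ≈ 0#
  sumF-zero zero f≈0 = refl
  sumF-zero (suc k) f≈0 = trans (+-cong (f≈0 zero) (sumF-zero k (f≈0 ∘ suc))) (+-identityˡ 0#)

  sumF-+ : ∀ k (f g : Fin k → Carrier) → sumF R k (λ i → f i + g i) ≈ sumF R k f + sumF R k g
  sumF-+ zero f g = sym (+-identityˡ 0#)
  sumF-+ (suc k) f g = begin
    (f zero + g zero) + sumF R k (λ i → f (suc i) + g (suc i))
      ≈⟨ +-congˡ (sumF-+ k (f ∘ suc) (g ∘ suc)) ⟩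
    (f zero + g zero) + (sumF R k (f ∘ suc) + sumF R k (g ∘ suc))
      ≈⟨ solve 4 (λ a b x y → (a :+ b) :+ (x :+ y) := (a :+ x) :+ (b :+ y)) refl _ _ _ _ ⟩
    sumF R (suc k) f + sumF R (suc k) g ∎

  sumF-*ˡ : ∀ k x (f : Fin k → Carrier) → sumF R k (λ i → x * f i) ≈ x * sumF R k f
  sumF-*ˡ zero x f = sym (zeroʳ x)
  sumF-*ˡ (suc k) x f = trans (+-congˡ (sumF-*ˡ k x (f ∘ suc))) (sym (distribˡ x _ _))

  sumF-neg : ∀ k (f : Fin k → Carrier) → sumF R k (λ i → - f i) ≈ - sumF R k f
  sumF-neg zero f = sym -0#≈0#
  sumF-neg (suc k) f = trans (+-congˡ (sumF-neg k (f ∘ suc))) (-‿+-comm _ _)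

  sumF-const : ∀ k x → sumF R k (λ _ → x) ≈ natR R k * x
  sumF-const zero x = sym (zeroˡ x)
  sumF-const (suc k) x = trans (+-cong (sym (*-identityˡ x)) (sumF-const k x)) (sym (distribʳ x 1# _))

  sumF-↑ : ∀ k l (f : Fin (k ℕ.+ l) → Carrier) →
    sumF R (k ℕ.+ l) f ≈ sumF R k (λ i → f (i ↑ˡ l)) + sumF R l (λ j → f (k ↑ʳ j))
  sumF-↑ zero l f = sym (+-identityˡ _)
  sumF-↑ (suc k) l f = trans (+-congˡ (sumF-↑ k l (f ∘ suc))) (sym (+-assoc _ _ _))

  sumF-combine : ∀ n s (f : Fin (n ℕ.* s) → Carrier) →
    sumF R (n ℕ.* s) f ≈ sumF R n (λ v → sumF R s (λ u → f (combine v u)))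
  sumF-combine zero s f = refl
  sumF-combine (suc n) s f = trans (sumF-↑ s (n ℕ.* s) f) (+-congˡ (sumF-combine n s (λ r → f (s ↑ʳ r))))

  altSum-cong : ∀ k {f g : Fin k → Carrier} → (∀ i → f i ≈ g i) → altSum R k f ≈ altSum R k g
  altSum-cong zero f≈g = refl
  altSum-cong (suc k) f≈g = +-cong (f≈g zero) (-‿cong (altSum-cong k (f≈g ∘ suc)))

  altSum-zero : ∀ k {f : Fin k → Carrier} → (∀ i → f i ≈ 0#) → altSum R k f ≈ 0#
  altSum-zero zero f≈0 = refl
  altSum-zero (suc k) {f} f≈0 = begin
    f zero - altSum R k (f ∘ suc) ≈⟨ +-cong (f≈0 zero) (-‿cong (altSum-zero k (f≈0 ∘ suc))) ⟩
    0# - 0#                       ≈⟨ -‿inverseʳ 0# ⟩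
    0#                            ∎

  altSum-+ : ∀ k (f g : Fin k → Carrier) → altSum R k (λ i → f i + g i) ≈ altSum R k f + altSum R k g
  altSum-+ zero f g = sym (+-identityˡ 0#)
  altSum-+ (suc k) f g = begin
    (f zero + g zero) - altSum R k (λ i → f (suc i) + g (suc i))
      ≈⟨ +-congˡ (-‿cong (altSum-+ k (f ∘ suc) (g ∘ suc))) ⟩
    (f zero + g zero) - (altSum R k (f ∘ suc) + altSum R k (g ∘ suc))
      ≈⟨ solve 4 (λ a b x y → (a :+ b) :- (x :+ y) := (a :- x) :+ (b :- y)) refl _ _ _ _ ⟩
    altSum R (suc k) f + altSum R (suc k) g ∎

  altSum-*ˡ : ∀ k x (f : Fin k → Carrier) → altSum R k (λ i → x * f i) ≈ x * altSum R k f
  altSum-*ˡ zero x f = sym (zeroʳ x)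
  altSum-*ˡ (suc k) x f = begin
    x * f zero - altSum R k (λ i → x * f (suc i)) ≈⟨ +-congˡ (-‿cong (altSum-*ˡ k x (f ∘ suc))) ⟩
    x * f zero - x * altSum R k (f ∘ suc)         ≈⟨ solve 3 (λ x a b → x :* a :- x :* b := x :* (a :- b)) refl _ _ _ ⟩
    x * altSum R (suc k) f                        ∎

  altSum-neg : ∀ k (f : Fin k → Carrier) → altSum R k (λ i → - f i) ≈ - altSum R k f
  altSum-neg zero f = sym -0#≈0#
  altSum-neg (suc k) f = begin
    - f zero - altSum R k (λ i → - f (suc i)) ≈⟨ +-congˡ (-‿cong (altSum-neg k (f ∘ suc))) ⟩
    - f zero - - altSum R k (f ∘ suc)         ≈⟨ solve 2 (λ a b → :- a :- :- b := :- (a :- b)) refl _ _ ⟩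
    - altSum R (suc k) f                      ∎

  altSum-comm : ∀ k l (f : Fin k → Fin l → Carrier) →
    altSum R k (λ i → altSum R l (f i)) ≈ altSum R l (λ j → altSum R k (λ i → f i j))
  altSum-comm zero l f = sym (altSum-zero l (λ _ → refl))
  altSum-comm (suc k) l f = begin
    altSum R l (f zero) - altSum R k (λ i → altSum R l (f (suc i)))
      ≈⟨ +-congˡ (-‿cong (altSum-comm k l (f ∘ suc))) ⟩
    altSum R l (f zero) - altSum R l (λ j → altSum R k (λ i → f (suc i) j))
      ≈⟨ +-congˡ (altSum-neg l _) ⟨
    altSum R l (f zero) + altSum R l (λ j → - altSum R k (λ i → f (suc i) j))
      ≈⟨ altSum-+ l (f zero) _ ⟨
    altSum R l (λ j → altSum R (suc k) (λ i → f i j)) ∎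

  altSum-↑ˡ : ∀ k l (f : Fin (k ℕ.+ l) → Carrier) → (∀ j → f (k ↑ʳ j) ≈ 0#) →
    altSum R (k ℕ.+ l) f ≈ altSum R k (λ i → f (i ↑ˡ l))
  altSum-↑ˡ zero l f tail≈0 = altSum-zero l tail≈0
  altSum-↑ˡ (suc k) l f tail≈0 = +-congˡ (-‿cong (altSum-↑ˡ k l (f ∘ suc) tail≈0))

  δ : ∀ {k} → Fin k → Fin k → Carrier
  δ zero    zero    = 1#
  δ zero    (suc _) = 0#
  δ (suc _) zero    = 0#
  δ (suc i) (suc j) = δ i j

  δ-refl : ∀ {k} (i : Fin k) → δ i i ≡ 1#
  δ-refl zero = ≡.refl
  δ-refl (suc i) = δ-refl i

  δ-≢ : ∀ {k} {i j : Fin k} → i ≢ j → δ i j ≡ 0#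
  δ-≢ {i = zero} {zero} i≢j = ⊥-elim (i≢j ≡.refl)
  δ-≢ {i = zero} {suc j} _ = ≡.refl
  δ-≢ {i = suc i} {zero} _ = ≡.refl
  δ-≢ {i = suc i} {suc j} i≢j = δ-≢ (i≢j ∘ ≡.cong suc)

  δ-sym : ∀ {k} (i j : Fin k) → δ i j ≡ δ j i
  δ-sym zero zero = ≡.refl
  δ-sym zero (suc j) = ≡.refl
  δ-sym (suc i) zero = ≡.refl
  δ-sym (suc i) (suc j) = δ-sym i j

  boolR-≟ : ∀ {k} (i j : Fin k) → boolR R ⌊ i Fin.≟ j ⌋ ≡ δ i j
  boolR-≟ i j with i Fin.≟ j
  ... | yes ≡.refl = ≡.sym (δ-refl i)
  ... | no i≢j = ≡.sym (δ-≢ i≢j)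

  δ-combine : ∀ {k n} (u u′ : Fin k) (w w′ : Fin n) → δ (combine u w) (combine u′ w′) ≈ δ u u′ * δ w w′
  δ-combine u u′ w w′ with u Fin.≟ u′ | w Fin.≟ w′
  ... | yes ≡.refl | yes ≡.refl = trans (reflexive (δ-refl (combine u w)))
      (sym (trans (reflexive (≡.cong₂ _*_ (δ-refl u) (δ-refl w))) (*-identityˡ 1#)))
  ... | no u≢u′ | _ = trans (reflexive (δ-≢ (u≢u′ ∘ proj₁ ∘ Fin.combine-injective u w u′ w′)))
      (sym (trans (*-congʳ (reflexive (δ-≢ u≢u′))) (zeroˡ _)))
  ... | yes _ | no w≢w′ = trans (reflexive (δ-≢ (w≢w′ ∘ proj₂ ∘ Fin.combine-injective u w u′ w′)))
      (sym (trans (*-congˡ (reflexive (δ-≢ w≢w′))) (zeroʳ _)))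

  sumF-δˡ : ∀ k (i : Fin k) (g : Fin k → Carrier) → sumF R k (λ j → δ j i * g j) ≈ g i
  sumF-δˡ (suc k) zero g = begin
    1# * g zero + sumF R k (λ j → 0# * g (suc j)) ≈⟨ +-cong (*-identityˡ _) (sumF-zero k (λ j → zeroˡ _)) ⟩
    g zero + 0#                                   ≈⟨ +-identityʳ _ ⟩
    g zero                                        ∎
  sumF-δˡ (suc k) (suc i) g = begin
    0# * g zero + sumF R k (λ j → δ j i * g (suc j)) ≈⟨ +-cong (zeroˡ _) (sumF-δˡ k i (g ∘ suc)) ⟩
    0# + g (suc i)                                   ≈⟨ +-identityˡ _ ⟩
    g (suc i)                                        ∎

  sumF-δʳ : ∀ k (i : Fin k) (g : Fin k → Carrier) → sumF R k (λ j → δ i j * g j) ≈ g i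
  sumF-δʳ k i g = trans (sumF-cong k (λ j → *-congʳ (reflexive (δ-sym i j)))) (sumF-δˡ k i g)

  -- Determinants: multilinearity, transposition, alternation

  minor : ∀ {k} → Fin (suc k) → Matrix R (suc k) → Matrix R k
  minor j M a b = M (suc a) (punchIn j b)

  det-cong : ∀ k {M N : Matrix R k} → (∀ a b → M a b ≈ N a b) → det R k M ≈ det R k N
  det-cong zero M≈N = refl
  det-cong (suc k) M≈N = altSum-cong (suc k) (λ j → *-cong (M≈N zero j) (det-cong k (λ a b → M≈N (suc a) (punchIn j b))))

  det-linearAt : ∀ k (t : Fin k) {M M₁ M₂ : Matrix R k} (x₁ x₂ : Carrier) →
    (∀ a b → b ≢ t → M₁ a b ≈ M a b) → (∀ a b → b ≢ t → M₂ a b ≈ M a b) →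
    (∀ a → M a t ≈ x₁ * M₁ a t + x₂ * M₂ a t) → det R k M ≈ x₁ * det R k M₁ + x₂ * det R k M₂
  det-linearAt (suc k) t {M} {M₁} {M₂} x₁ x₂ M₁≈M M₂≈M column-t = begin
    altSum R (suc k) (λ j → M zero j * det R k (minor j M))
      ≈⟨ altSum-cong (suc k) (λ j → term j (j Fin.≟ t)) ⟩
    altSum R (suc k) (λ j → x₁ * (M₁ zero j * det R k (minor j M₁)) + x₂ * (M₂ zero j * det R k (minor j M₂)))
      ≈⟨ altSum-+ (suc k) (λ j → x₁ * (M₁ zero j * det R k (minor j M₁))) (λ j → x₂ * (M₂ zero j * det R k (minor j M₂))) ⟩
    altSum R (suc k) (λ j → x₁ * (M₁ zero j * det R k (minor j M₁))) + altSum R (suc k) (λ j → x₂ * (M₂ zero j * det R k (minor j M₂)))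
      ≈⟨ +-cong (altSum-*ˡ (suc k) x₁ (λ j → M₁ zero j * det R k (minor j M₁))) (altSum-*ˡ (suc k) x₂ (λ j → M₂ zero j * det R k (minor j M₂))) ⟩
    x₁ * det R (suc k) M₁ + x₂ * det R (suc k) M₂ ∎
    where
    term : ∀ j → Dec (j ≡ t) → M zero j * det R k (minor j M) ≈ x₁ * (M₁ zero j * det R k (minor j M₁)) + x₂ * (M₂ zero j * det R k (minor j M₂))
    term j (yes ≡.refl) = begin
      M zero j * det R k (minor j M)
        ≈⟨ *-congʳ (column-t zero) ⟩
      (x₁ * M₁ zero j + x₂ * M₂ zero j) * det R k (minor j M)
        ≈⟨ solve 5 (λ x₁ x₂ y₁ y₂ d → (x₁ :* y₁ :+ x₂ :* y₂) :* d := x₁ :* (y₁ :* d) :+ x₂ :* (y₂ :* d)) refl _ _ _ _ _ ⟩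
      x₁ * (M₁ zero j * det R k (minor j M)) + x₂ * (M₂ zero j * det R k (minor j M))
        ≈⟨ +-cong (*-congˡ (*-congˡ (det-cong k (λ a b → sym (M₁≈M (suc a) (punchIn j b) (Fin.punchInᵢ≢i j b))))))
                  (*-congˡ (*-congˡ (det-cong k (λ a b → sym (M₂≈M (suc a) (punchIn j b) (Fin.punchInᵢ≢i j b)))))) ⟩
      x₁ * (M₁ zero j * det R k (minor j M₁)) + x₂ * (M₂ zero j * det R k (minor j M₂)) ∎
    term j (no j≢t) = begin
      M zero j * det R k (minor j M)
        ≈⟨ *-congˡ minor-linear ⟩
      M zero j * (x₁ * det R k (minor j M₁) + x₂ * det R k (minor j M₂))
        ≈⟨ solve 5 (λ x₁ x₂ y d₁ d₂ → y :* (x₁ :* d₁ :+ x₂ :* d₂) := x₁ :* (y :* d₁) :+ x₂ :* (y :* d₂)) refl _ _ _ _ _ ⟩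
      x₁ * (M zero j * det R k (minor j M₁)) + x₂ * (M zero j * det R k (minor j M₂))
        ≈⟨ +-cong (*-congˡ (*-congʳ (sym (M₁≈M zero j j≢t)))) (*-congˡ (*-congʳ (sym (M₂≈M zero j j≢t)))) ⟩
      x₁ * (M₁ zero j * det R k (minor j M₁)) + x₂ * (M₂ zero j * det R k (minor j M₂)) ∎
      where
      t′ : Fin k
      t′ = punchOut j≢t
      ↑t′ : punchIn j t′ ≡ t
      ↑t′ = Fin.punchIn-punchOut j≢t
      ↑≢t : ∀ b → b ≢ t′ → punchIn j b ≢ t
      ↑≢t b b≢t′ eq = b≢t′ (Fin.punchIn-injective j b t′ (≡.trans eq (≡.sym ↑t′)))
      minor-linear : det R k (minor j M) ≈ x₁ * det R k (minor j M₁) + x₂ * det R k (minor j M₂)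
      minor-linear = det-linearAt k t′ x₁ x₂
        (λ a b b≢t′ → M₁≈M (suc a) (punchIn j b) (↑≢t b b≢t′))
        (λ a b b≢t′ → M₂≈M (suc a) (punchIn j b) (↑≢t b b≢t′))
        (λ a → ≡.subst (λ z → M (suc a) z ≈ x₁ * M₁ (suc a) z + x₂ * M₂ (suc a) z) (≡.sym ↑t′) (column-t (suc a)))

  detByColumn : ∀ k → Matrix R k → Carrier
  detByColumn zero M = 1#
  detByColumn (suc k) M = altSum R (suc k) (λ i → M i zero * detByColumn k (λ a b → M (punchIn i a) (suc b)))

  altSum-interchange : ∀ k l (x : Fin l → Carrier) (y : Fin k → Carrier) (Z : Fin k → Fin l → Carrier) →
    altSum R l (λ j → x j * altSum R k (λ i → y i * Z i j)) ≈ altSum R k (λ i → y i * altSum R l (λ j → x j * Z i j))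
  altSum-interchange k l x y Z = begin
    altSum R l (λ j → x j * altSum R k (λ i → y i * Z i j))
      ≈⟨ altSum-cong l (λ j → trans (sym (altSum-*ˡ k (x j) _)) (altSum-cong k (λ i → x*[y*z]≈y*[x*z] (x j) (y i) (Z i j)))) ⟩
    altSum R l (λ j → altSum R k (λ i → y i * (x j * Z i j)))
      ≈⟨ altSum-comm k l (λ i j → y i * (x j * Z i j)) ⟨
    altSum R k (λ i → altSum R l (λ j → y i * (x j * Z i j)))
      ≈⟨ altSum-cong k (λ i → altSum-*ˡ l (y i) _) ⟩
    altSum R k (λ i → y i * altSum R l (λ j → x j * Z i j)) ∎
    where
    x*[y*z]≈y*[x*z] : ∀ x y z → x * (y * z) ≈ y * (x * z)
    x*[y*z]≈y*[x*z] = solve 3 (λ x y z → x :* (y :* z) := y :* (x :* z)) refl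

  -- Both expansions reduce to expanding the (1,1)-minors along row and column 0, and the two
  -- resulting double alternating sums agree.
  det≈detByColumn : ∀ k (M : Matrix R k) → det R k M ≈ detByColumn k M
  det≈detByColumn zero M = refl
  det≈detByColumn (suc zero) M = refl
  det≈detByColumn (suc (suc k)) M =
    +-cong (*-congˡ (det≈detByColumn (suc k) (λ a b → M (suc a) (suc b)))) (-‿cong (begin
      altSum R (suc k) (λ j → M zero (suc j) * det R (suc k) (minor (suc j) M))
        ≈⟨ altSum-cong (suc k) {g = λ j → M zero (suc j) * altSum R (suc k) (λ i → M (suc i) zero * det R k (minor₂ i j))}
             (λ j → *-congˡ (trans (det≈detByColumn (suc k) (minor (suc j) M))
               (altSum-cong (suc k) {g = λ i → M (suc i) zero * det R k (minor₂ i j)} (λ i → *-congˡ (sym (det≈detByColumn k _)))))) ⟩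
      altSum R (suc k) (λ j → M zero (suc j) * altSum R (suc k) (λ i → M (suc i) zero * det R k (minor₂ i j)))
        ≈⟨ altSum-interchange (suc k) (suc k) (λ j → M zero (suc j)) (λ i → M (suc i) zero) (λ i j → det R k (minor₂ i j)) ⟩
      altSum R (suc k) (λ i → M (suc i) zero * altSum R (suc k) (λ j → M zero (suc j) * det R k (minor₂ i j)))
        ≈⟨ altSum-cong (suc k) {g = λ i → M (suc i) zero * detByColumn (suc k) (λ a b → M (punchIn (suc i) a) (suc b))}
             (λ i → *-congˡ (det≈detByColumn (suc k) (λ a b → M (punchIn (suc i) a) (suc b)))) ⟩
      altSum R (suc k) (λ i → M (suc i) zero * detByColumn (suc k) (λ a b → M (punchIn (suc i) a) (suc b))) ∎))
    where
    minor₂ : Fin (suc k) → Fin (suc k) → Matrix R k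
    minor₂ i j a b = M (suc (punchIn i a)) (suc (punchIn j b))

  det-transpose : ∀ k (M : Matrix R k) → det R k (λ a b → M b a) ≈ det R k M
  det-transpose zero M = refl
  det-transpose (suc k) M = begin
    altSum R (suc k) (λ j → M j zero * det R k (λ a b → M (punchIn j b) (suc a)))
      ≈⟨ altSum-cong (suc k) {g = λ j → M j zero * detByColumn k (λ a b → M (punchIn j a) (suc b))}
           (λ j → *-congˡ (trans (det-transpose k _) (det≈detByColumn k _))) ⟩
    detByColumn (suc k) M ≈⟨ det≈detByColumn (suc k) M ⟨
    det R (suc k) M ∎

  setColumn : ∀ {k} → Matrix R k → Fin k → (Fin k → Carrier) → Matrix R k
  setColumn M t v a b with b Fin.≟ t
  ... | yes _ = v a
  ... | no _ = M a b

  setColumn-≡ : ∀ {k} (M : Matrix R k) t v a → setColumn M t v a t ≡ v a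
  setColumn-≡ M t v a with t Fin.≟ t
  ... | yes _ = ≡.refl
  ... | no t≢t = ⊥-elim (t≢t ≡.refl)

  setColumn-≢ : ∀ {k} (M : Matrix R k) t v a {b} → b ≢ t → setColumn M t v a b ≡ M a b
  setColumn-≢ M t v a {b} b≢t with b Fin.≟ t
  ... | yes b≡t = ⊥-elim (b≢t b≡t)
  ... | no _ = ≡.refl

  setColumn-self : ∀ {k} (M : Matrix R k) t a b → setColumn M t (λ a → M a t) a b ≡ M a b
  setColumn-self M t a b with b Fin.≟ t
  ... | yes ≡.refl = ≡.refl
  ... | no _ = ≡.refl

  setColumn-comm : ∀ {k} (M : Matrix R k) {i j} → i ≢ j → ∀ u v a b →
    setColumn (setColumn M i u) j v a b ≡ setColumn (setColumn M j v) i u a b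
  setColumn-comm M {i} {j} i≢j u v a b = go (b Fin.≟ i) (b Fin.≟ j)
    where
    go : Dec (b ≡ i) → Dec (b ≡ j) → setColumn (setColumn M i u) j v a b ≡ setColumn (setColumn M j v) i u a b
    go (yes ≡.refl) (yes ≡.refl) = ⊥-elim (i≢j ≡.refl)
    go (yes ≡.refl) (no b≢j) = ≡.trans (setColumn-≢ (setColumn M i u) j v a b≢j)
      (≡.trans (setColumn-≡ M i u a) (≡.sym (setColumn-≡ (setColumn M j v) i u a)))
    go (no b≢i) (yes ≡.refl) = ≡.trans (setColumn-≡ (setColumn M i u) j v a)
      (≡.trans (≡.sym (setColumn-≡ M j v a)) (≡.sym (setColumn-≢ (setColumn M j v) i u a b≢i)))
    go (no b≢i) (no b≢j) = ≡.trans (setColumn-≢ (setColumn M i u) j v a b≢j)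
      (≡.trans (setColumn-≢ M i u a b≢i) (≡.sym (≡.trans (setColumn-≢ (setColumn M j v) i u a b≢i) (setColumn-≢ M j v a b≢j))))

  det-setColumn-+ : ∀ k (M : Matrix R k) t (u v : Fin k → Carrier) →
    det R k (setColumn M t (λ a → u a + v a)) ≈ det R k (setColumn M t u) + det R k (setColumn M t v)
  det-setColumn-+ k M t u v = begin
    det R k (setColumn M t (λ a → u a + v a))
      ≈⟨ det-linearAt k t 1# 1# (same-off-t u) (same-off-t v) column-t ⟩
    1# * det R k (setColumn M t u) + 1# * det R k (setColumn M t v)
      ≈⟨ +-cong (*-identityˡ _) (*-identityˡ _) ⟩
    det R k (setColumn M t u) + det R k (setColumn M t v) ∎
    where
    same-off-t : ∀ w a b → b ≢ t → setColumn M t w a b ≈ setColumn M t (λ a → u a + v a) a b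
    same-off-t w a b b≢t = reflexive (≡.trans (setColumn-≢ M t w a b≢t) (≡.sym (setColumn-≢ M t _ a b≢t)))
    column-t : ∀ a → setColumn M t (λ a → u a + v a) a t ≈ 1# * setColumn M t u a t + 1# * setColumn M t v a t
    column-t a = begin
      setColumn M t (λ a → u a + v a) a t ≡⟨ setColumn-≡ M t _ a ⟩
      u a + v a                           ≈⟨ +-cong (*-identityˡ (u a)) (*-identityˡ (v a)) ⟨
      1# * u a + 1# * v a                 ≡⟨ ≡.cong₂ (λ p q → 1# * p + 1# * q) (setColumn-≡ M t u a) (setColumn-≡ M t v a) ⟨
      1# * setColumn M t u a t + 1# * setColumn M t v a t ∎

  det-setColumn-*ˡ : ∀ k (M : Matrix R k) t x (u : Fin k → Carrier) →
    det R k (setColumn M t (λ a → x * u a)) ≈ x * det R k (setColumn M t u)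
  det-setColumn-*ˡ k M t x u = begin
    det R k (setColumn M t (λ a → x * u a))
      ≈⟨ det-linearAt k t {setColumn M t (λ a → x * u a)} {setColumn M t u} {setColumn M t u} x 0#
           (λ a b b≢t → reflexive (≡.trans (setColumn-≢ M t u a b≢t) (≡.sym (setColumn-≢ M t _ a b≢t))))
           (λ a b b≢t → reflexive (≡.trans (setColumn-≢ M t u a b≢t) (≡.sym (setColumn-≢ M t _ a b≢t))))
           (λ a → trans (reflexive (≡.trans (setColumn-≡ M t _ a) (≡.cong (x *_) (≡.sym (setColumn-≡ M t u a)))))
                        (sym (trans (+-congˡ (zeroˡ _)) (+-identityʳ _)))) ⟩
    x * det R k (setColumn M t u) + 0# * det R k (setColumn M t u)
      ≈⟨ trans (+-congˡ (zeroˡ _)) (+-identityʳ _) ⟩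
    x * det R k (setColumn M t u) ∎

  det-zeroColumn : ∀ k (M : Matrix R k) t → (∀ a → M a t ≈ 0#) → det R k M ≈ 0#
  det-zeroColumn k M t column≈0 = begin
    det R k M                         ≈⟨ det-linearAt k t 0# 0# (λ _ _ _ → refl) (λ _ _ _ → refl) column≈0+0 ⟩
    0# * det R k M + 0# * det R k M   ≈⟨ trans (+-cong (zeroˡ _) (zeroˡ _)) (+-identityˡ 0#) ⟩
    0#                                ∎
    where
    column≈0+0 : ∀ a → M a t ≈ 0# * M a t + 0# * M a t
    column≈0+0 a = trans (column≈0 a) (sym (trans (+-cong (zeroˡ _) (zeroˡ _)) (+-identityˡ 0#)))

  det-setColumn-sumF : ∀ k (M : Matrix R k) t n (g : Fin k → Fin n → Carrier) →
    det R k (setColumn M t (λ a → sumF R n (g a))) ≈ sumF R n (λ j → det R k (setColumn M t (λ a → g a j)))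
  det-setColumn-sumF k M t zero g =
    det-zeroColumn k (setColumn M t (λ _ → 0#)) t (λ a → reflexive (setColumn-≡ M t _ a))
  det-setColumn-sumF k M t (suc n) g = begin
    det R k (setColumn M t (λ a → g a zero + sumF R n (g a ∘ suc)))
      ≈⟨ det-setColumn-+ k M t (λ a → g a zero) (λ a → sumF R n (g a ∘ suc)) ⟩
    det R k (setColumn M t (λ a → g a zero)) + det R k (setColumn M t (λ a → sumF R n (g a ∘ suc)))
      ≈⟨ +-congˡ (det-setColumn-sumF k M t n (λ a j → g a (suc j))) ⟩
    sumF R (suc n) (λ j → det R k (setColumn M t (λ a → g a j))) ∎

  altSum-swapConsecutive : ∀ k {f g : Fin k → Carrier} {i j : Fin k} → Consecutive i j →
    (∀ c → c ≢ i → c ≢ j → g c ≈ - f c) → g i ≈ f j → g j ≈ f i → altSum R k g ≈ - altSum R k f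
  altSum-swapConsecutive (suc (suc k)) {f} {g} {zero} {suc zero} _ g≈-f gᵢ≈fⱼ gⱼ≈fᵢ = begin
    g zero - (g (suc zero) - altSum R k (λ c → g (suc (suc c))))
      ≈⟨ +-cong gᵢ≈fⱼ (-‿cong (+-cong gⱼ≈fᵢ (-‿cong (trans (altSum-cong k (λ c → g≈-f (suc (suc c)) (λ ()) (λ ()))) (altSum-neg k _))))) ⟩
    f (suc zero) - (f zero - - altSum R k (λ c → f (suc (suc c))))
      ≈⟨ solve 3 (λ x y z → y :- (x :- :- z) := :- (x :- (y :- z))) refl _ _ _ ⟩
    - altSum R (suc (suc k)) f ∎
  altSum-swapConsecutive (suc k) {i = zero} {suc (suc j)} ()
  altSum-swapConsecutive (suc k) {i = i} {zero} ()
  altSum-swapConsecutive (suc (suc k)) {f} {g} {suc i} {suc j} i⋖j g≈-f gᵢ≈fⱼ gⱼ≈fᵢ = begin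
    g zero - altSum R (suc k) (g ∘ suc)
      ≈⟨ +-cong (g≈-f zero (λ ()) (λ ()))
                (-‿cong (altSum-swapConsecutive (suc k) (ℕ.suc-injective i⋖j)
                  (λ c c≢i c≢j → g≈-f (suc c) (c≢i ∘ Fin.suc-injective) (c≢j ∘ Fin.suc-injective)) gᵢ≈fⱼ gⱼ≈fᵢ)) ⟩
    - f zero - - altSum R (suc k) (f ∘ suc)
      ≈⟨ solve 2 (λ x z → :- x :- :- z := :- (x :- z)) refl _ _ ⟩
    - altSum R (suc (suc k)) f ∎

  altSum-equalConsecutive : ∀ k {f : Fin k → Carrier} {i j : Fin k} → Consecutive i j →
    (∀ c → c ≢ i → c ≢ j → f c ≈ 0#) → f i ≈ f j → altSum R k f ≈ 0#
  altSum-equalConsecutive (suc (suc k)) {f} {zero} {suc zero} _ f≈0 fᵢ≈fⱼ = begin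
    f zero - (f (suc zero) - altSum R k (λ c → f (suc (suc c))))
      ≈⟨ +-cong fᵢ≈fⱼ (-‿cong (+-congˡ (-‿cong (altSum-zero k (λ c → f≈0 (suc (suc c)) (λ ()) (λ ())))))) ⟩
    f (suc zero) - (f (suc zero) - 0#)
      ≈⟨ solve 1 (λ x → x :- (x :- con (+ 0)) := con (+ 0)) refl _ ⟩
    0# ∎
  altSum-equalConsecutive (suc k) {i = zero} {suc (suc j)} ()
  altSum-equalConsecutive (suc k) {i = i} {zero} ()
  altSum-equalConsecutive (suc (suc k)) {f} {suc i} {suc j} i⋖j f≈0 fᵢ≈fⱼ = begin
    f zero - altSum R (suc k) (f ∘ suc)
      ≈⟨ +-cong (f≈0 zero (λ ()) (λ ()))
                (-‿cong (altSum-equalConsecutive (suc k) (ℕ.suc-injective i⋖j)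
                  (λ c c≢i c≢j → f≈0 (suc c) (c≢i ∘ Fin.suc-injective) (c≢j ∘ Fin.suc-injective)) fᵢ≈fⱼ)) ⟩
    0# - 0# ≈⟨ -‿inverseʳ 0# ⟩
    0# ∎

  swapColumns : ∀ {k} → Matrix R k → Fin k → Fin k → Matrix R k
  swapColumns M i j a b = M a (transpose i j b)

  det-swapConsecutiveColumns : ∀ k (M : Matrix R k) {i j : Fin k} → Consecutive i j →
    det R k (swapColumns M i j) ≈ - det R k M
  det-swapConsecutiveColumns (suc k) M {i} {j} i⋖j = altSum-swapConsecutive (suc k) i⋖j other at-i at-j
    where
    other : ∀ c → c ≢ i → c ≢ j →
      M zero (transpose i j c) * det R k (minor c (swapColumns M i j)) ≈ - (M zero c * det R k (minor c M))
    other c c≢i c≢j = begin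
      M zero (transpose i j c) * det R k (minor c (swapColumns M i j))
        ≈⟨ *-cong (reflexive (≡.cong (M zero) (transpose-≢ c≢i c≢j)))
                  (det-cong k (λ a b → reflexive (≡.cong (M (suc a)) (transpose-punchIn c≢i c≢j b)))) ⟩
      M zero c * det R k (swapColumns (minor c M) (punchOut c≢i) (punchOut c≢j))
        ≈⟨ *-congˡ (det-swapConsecutiveColumns k (minor c M) (punchOut-consecutive i⋖j c≢i c≢j)) ⟩
      M zero c * - det R k (minor c M) ≈⟨ -‿distribʳ-* _ _ ⟨
      - (M zero c * det R k (minor c M)) ∎
    at-i : M zero (transpose i j i) * det R k (minor i (swapColumns M i j)) ≈ M zero j * det R k (minor j M)
    at-i = *-cong (reflexive (≡.cong (M zero) (transpose-i i j)))
                  (det-cong k (λ a b → reflexive (≡.cong (M (suc a)) (transpose-punchInˡ i⋖j b))))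
    at-j : M zero (transpose i j j) * det R k (minor j (swapColumns M i j)) ≈ M zero i * det R k (minor i M)
    at-j = *-cong (reflexive (≡.cong (M zero) (transpose-j (Consecutive⇒≢ i⋖j))))
                  (det-cong k (λ a b → reflexive (≡.cong (M (suc a)) (transpose-punchInʳ i⋖j b))))

  det-equalConsecutiveColumns : ∀ k (M : Matrix R k) {i j : Fin k} → Consecutive i j →
    (∀ a → M a i ≈ M a j) → det R k M ≈ 0#
  det-equalConsecutiveColumns (suc k) M {i} {j} i⋖j Mᵢ≈Mⱼ = altSum-equalConsecutive (suc k) i⋖j other at-i≈at-j
    where
    other : ∀ c → c ≢ i → c ≢ j → M zero c * det R k (minor c M) ≈ 0#
    other c c≢i c≢j = trans (*-congˡ (det-equalConsecutiveColumns k (minor c M) (punchOut-consecutive i⋖j c≢i c≢j)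
      (λ a → trans (reflexive (≡.cong (M (suc a)) (Fin.punchIn-punchOut c≢i)))
               (trans (Mᵢ≈Mⱼ (suc a)) (reflexive (≡.cong (M (suc a)) (≡.sym (Fin.punchIn-punchOut c≢j))))))))
      (zeroʳ _)
    minors-agree : ∀ a b → M (suc a) (punchIn i b) ≈ M (suc a) (punchIn j b)
    minors-agree a b with punchIn-consecutive i⋖j b
    ... | inj₁ eq = reflexive (≡.cong (M (suc a)) eq)
    ... | inj₂ (eqᵢ , eqⱼ) = trans (reflexive (≡.cong (M (suc a)) eqᵢ))
                               (trans (sym (Mᵢ≈Mⱼ (suc a))) (reflexive (≡.cong (M (suc a)) (≡.sym eqⱼ))))
    at-i≈at-j : M zero i * det R k (minor i M) ≈ M zero j * det R k (minor j M)
    at-i≈at-j = *-cong (Mᵢ≈Mⱼ zero) (det-cong k minors-agree)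

  -- Moving column j leftwards by a consecutive swap only changes the sign, and decreases the gap d.
  det-equalColumnsAtGap : ∀ k d (M : Matrix R k) {i j : Fin k} → toℕ j ≡ suc (toℕ i ℕ.+ d) →
    (∀ a → M a i ≈ M a j) → det R k M ≈ 0#
  det-equalColumnsAtGap k zero M j≡1+i Mᵢ≈Mⱼ =
    det-equalConsecutiveColumns k M (≡.trans j≡1+i (≡.cong suc (ℕ.+-identityʳ _))) Mᵢ≈Mⱼ
  det-equalColumnsAtGap k (suc d) M {i} {zero} () _
  det-equalColumnsAtGap k (suc d) M {i} {suc j} j≡ Mᵢ≈Mⱼ = begin
    det R k M                                ≈⟨ -‿involutive _ ⟨
    - - det R k M                            ≈⟨ -‿cong (det-swapConsecutiveColumns k M j⁻⋖j) ⟨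
    - det R k (swapColumns M j⁻ (suc j))     ≈⟨ -‿cong (det-equalColumnsAtGap k d (swapColumns M j⁻ (suc j)) j⁻≡ swapped) ⟩
    - 0#                                     ≈⟨ -0#≈0# ⟩
    0#                                       ∎
    where
    j⁻ : Fin k
    j⁻ = Fin.inject₁ j
    j⁻⋖j : Consecutive j⁻ (suc j)
    j⁻⋖j = ≡.cong suc (≡.sym (Fin.toℕ-inject₁ j))
    j⁻≡ : toℕ j⁻ ≡ suc (toℕ i ℕ.+ d)
    j⁻≡ = ≡.trans (Fin.toℕ-inject₁ j) (≡.trans (ℕ.suc-injective j≡) (ℕ.+-suc (toℕ i) d))
    i≢ : ∀ {l : Fin k} {e} → toℕ l ≡ suc (toℕ i ℕ.+ e) → i ≢ l
    i≢ l≡ i≡l = ℕ.m≢1+m+n (toℕ i) (≡.trans (≡.cong toℕ i≡l) l≡)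
    swapped : ∀ a → swapColumns M j⁻ (suc j) a i ≈ swapColumns M j⁻ (suc j) a j⁻
    swapped a = trans (reflexive (≡.cong (M a) (transpose-≢ (i≢ j⁻≡) (i≢ j≡))))
                (trans (Mᵢ≈Mⱼ a) (reflexive (≡.cong (M a) (≡.sym (transpose-i j⁻ (suc j))))))

  det-equalColumns : ∀ k (M : Matrix R k) {i j : Fin k} → i ≢ j → (∀ a → M a i ≈ M a j) → det R k M ≈ 0#
  det-equalColumns k M {i} {j} i≢j Mᵢ≈Mⱼ with ℕ.<-cmp (toℕ i) (toℕ j)
  ... | tri< i<j _ _ = let (d , eq) = ℕ.m≤n⇒∃[o]m+o≡n i<j in det-equalColumnsAtGap k d M (≡.sym eq) Mᵢ≈Mⱼ
  ... | tri≈ _ i≡j _ = ⊥-elim (i≢j (Fin.toℕ-injective i≡j))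
  ... | tri> _ _ j<i = let (d , eq) = ℕ.m≤n⇒∃[o]m+o≡n j<i in det-equalColumnsAtGap k d M (≡.sym eq) (λ a → sym (Mᵢ≈Mⱼ a))

  -- det is alternating and additive in columns i and j, so expanding det P(x+y, x+y) = 0 leaves
  -- det P(x, y) + det P(y, x) = 0, where P(u, v) has columns u and v in positions i and j.
  det-swapColumns : ∀ k (M : Matrix R k) {i j : Fin k} → i ≢ j → det R k (swapColumns M i j) ≈ - det R k M
  det-swapColumns k M {i} {j} i≢j = begin
    det R k (swapColumns M i j)                            ≈⟨ solve 2 (λ s d → s := (s :+ d) :- d) refl _ _ ⟩
    (det R k (swapColumns M i j) + det R k M) - det R k M  ≈⟨ +-congʳ sum≈0 ⟩
    0# - det R k M                                         ≈⟨ +-identityˡ _ ⟩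
    - det R k M                                            ∎
    where
    P : (Fin k → Carrier) → (Fin k → Carrier) → Matrix R k
    P u v = setColumn (setColumn M i u) j v
    x y : Fin k → Carrier
    x a = M a i
    y a = M a j
    P-at-i : ∀ u v a → P u v a i ≡ u a
    P-at-i u v a = ≡.trans (setColumn-≢ (setColumn M i u) j v a i≢j) (setColumn-≡ M i u a)
    P-at-j : ∀ u v a → P u v a j ≡ v a
    P-at-j u v a = setColumn-≡ (setColumn M i u) j v a
    P-elsewhere : ∀ u v a {b} → b ≢ i → b ≢ j → P u v a b ≡ M a b
    P-elsewhere u v a b≢i b≢j = ≡.trans (setColumn-≢ (setColumn M i u) j v a b≢j) (setColumn-≢ M i u a b≢i)
    P-diagonal : ∀ u → det R k (P u u) ≈ 0#
    P-diagonal u = det-equalColumns k (P u u) i≢j (λ a → reflexive (≡.trans (P-at-i u u a) (≡.sym (P-at-j u u a))))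
    P-+ʳ : ∀ u v w → det R k (P u (λ a → v a + w a)) ≈ det R k (P u v) + det R k (P u w)
    P-+ʳ u = det-setColumn-+ k (setColumn M i u) j
    P-+ˡ : ∀ u v w → det R k (P (λ a → u a + v a) w) ≈ det R k (P u w) + det R k (P v w)
    P-+ˡ u v w = begin
      det R k (P (λ a → u a + v a) w)
        ≈⟨ det-cong k (λ a b → reflexive (setColumn-comm M i≢j _ w a b)) ⟩
      det R k (setColumn (setColumn M j w) i (λ a → u a + v a))
        ≈⟨ det-setColumn-+ k (setColumn M j w) i u v ⟩
      det R k (setColumn (setColumn M j w) i u) + det R k (setColumn (setColumn M j w) i v)
        ≈⟨ +-cong (det-cong k (λ a b → reflexive (setColumn-comm M i≢j u w a b)))
                  (det-cong k (λ a b → reflexive (setColumn-comm M i≢j v w a b))) ⟨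
      det R k (P u w) + det R k (P v w) ∎
    P-x-y : ∀ a b → Dec (b ≡ i) → Dec (b ≡ j) → P x y a b ≈ M a b
    P-x-y a b (yes ≡.refl) _ = reflexive (P-at-i x y a)
    P-x-y a b (no _) (yes ≡.refl) = reflexive (P-at-j x y a)
    P-x-y a b (no b≢i) (no b≢j) = reflexive (P-elsewhere x y a b≢i b≢j)
    P-y-x : ∀ a b → Dec (b ≡ i) → Dec (b ≡ j) → P y x a b ≈ swapColumns M i j a b
    P-y-x a b (yes ≡.refl) _ = reflexive (≡.trans (P-at-i y x a) (≡.cong (M a) (≡.sym (transpose-i i j))))
    P-y-x a b (no _) (yes ≡.refl) = reflexive (≡.trans (P-at-j y x a) (≡.cong (M a) (≡.sym (transpose-j i≢j))))
    P-y-x a b (no b≢i) (no b≢j) = reflexive (≡.trans (P-elsewhere y x a b≢i b≢j) (≡.cong (M a) (≡.sym (transpose-≢ b≢i b≢j))))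
    x+y : Fin k → Carrier
    x+y a = x a + y a
    sum≈0 : det R k (swapColumns M i j) + det R k M ≈ 0#
    sum≈0 = begin
      det R k (swapColumns M i j) + det R k M
        ≈⟨ +-comm _ _ ⟩
      det R k M + det R k (swapColumns M i j)
        ≈⟨ +-cong (det-cong k (λ a b → P-x-y a b (b Fin.≟ i) (b Fin.≟ j)))
                  (det-cong k (λ a b → P-y-x a b (b Fin.≟ i) (b Fin.≟ j))) ⟨
      det R k (P x y) + det R k (P y x)
        ≈⟨ +-cong (+-identityˡ _) (+-identityʳ _) ⟨
      (0# + det R k (P x y)) + (det R k (P y x) + 0#)
        ≈⟨ +-cong (+-congʳ (P-diagonal x)) (+-congˡ (P-diagonal y)) ⟨
      (det R k (P x x) + det R k (P x y)) + (det R k (P y x) + det R k (P y y))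
        ≈⟨ +-cong (P-+ʳ x x y) (P-+ʳ y x y) ⟨
      det R k (P x x+y) + det R k (P y x+y)
        ≈⟨ P-+ˡ x y x+y ⟨
      det R k (P x+y x+y)
        ≈⟨ P-diagonal x+y ⟩
      0# ∎

  det-swapRows : ∀ k (M : Matrix R k) {i j : Fin k} → i ≢ j → det R k (λ a b → M (transpose i j a) b) ≈ - det R k M
  det-swapRows k M i≢j = begin
    det R k (λ a b → M (transpose _ _ a) b)  ≈⟨ det-transpose k _ ⟨
    det R k (swapColumns (λ a b → M b a) _ _) ≈⟨ det-swapColumns k (λ a b → M b a) i≢j ⟩
    - det R k (λ a b → M b a)                ≈⟨ -‿cong (det-transpose k M) ⟩
    - det R k M                              ∎

  det-swapRowsAndColumns : ∀ k (M : Matrix R k) (i j : Fin k) →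
    det R k (λ a b → M (transpose i j a) (transpose i j b)) ≈ det R k M
  det-swapRowsAndColumns k M i j with i Fin.≟ j
  ... | yes ≡.refl = det-cong k (λ a b → reflexive (≡.cong₂ M (transpose-ii i a) (transpose-ii i b)))
  ... | no i≢j = begin
    det R k (λ a b → M (transpose i j a) (transpose i j b)) ≈⟨ det-swapColumns k (λ a b → M (transpose i j a) b) i≢j ⟩
    - det R k (λ a b → M (transpose i j a) b)               ≈⟨ -‿cong (det-swapRows k M i≢j) ⟩
    - - det R k M                                          ≈⟨ -‿involutive _ ⟩
    det R k M                                              ∎

  det-permute : ∀ k (π : Permutation′ k) (M : Matrix R k) → det R k (λ a b → M (π ⟨$⟩ʳ a) (π ⟨$⟩ʳ b)) ≈ det R k M
  det-permute k π M = trans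
    (det-cong k (λ a b → reflexive (≡.sym (≡.cong₂ M (eval-decompose π a) (eval-decompose π b)))))
    (permute-eval (decompose π) M)
    where
    permute-eval : ∀ (τs : TranspositionList k) (N : Matrix R k) →
      det R k (λ a b → N (eval τs ⟨$⟩ʳ a) (eval τs ⟨$⟩ʳ b)) ≈ det R k N
    permute-eval [] N = refl
    permute-eval ((i , j) ∷ τs) N =
      trans (det-swapRowsAndColumns k (λ a b → N (eval τs ⟨$⟩ʳ a) (eval τs ⟨$⟩ʳ b)) i j) (permute-eval τs N)

  det-reindex : ∀ {k k′} → k ≡ k′ → (f : Fin k → Fin k′) (g : Fin k′ → Fin k) →
    (∀ x → f (g x) ≡ x) → (∀ x → g (f x) ≡ x) → (M : Matrix R k′) →
    det R k (λ a b → M (f a) (f b)) ≈ det R k′ M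
  det-reindex {k} ≡.refl f g f∘g g∘f = det-permute k (permutation f g f∘g g∘f)

  det-blockLowerTriangular : ∀ s t (M : Matrix R (s ℕ.+ t)) → (∀ a b → M (a ↑ˡ t) (s ↑ʳ b) ≈ 0#) →
    det R (s ℕ.+ t) M ≈ det R s (λ a b → M (a ↑ˡ t) (b ↑ˡ t)) * det R t (λ a b → M (s ↑ʳ a) (s ↑ʳ b))
  det-blockLowerTriangular zero t M _ = sym (*-identityˡ _)
  det-blockLowerTriangular (suc s) t M upperRight≈0 = begin
    altSum R (suc s ℕ.+ t) (λ j → M zero j * det R (s ℕ.+ t) (minor j M))
      ≈⟨ altSum-↑ˡ (suc s) t (λ j → M zero j * det R (s ℕ.+ t) (minor j M)) (λ j → trans (*-congʳ (upperRight≈0 zero j)) (zeroˡ _)) ⟩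
    altSum R (suc s) (λ i → M zero (i ↑ˡ t) * det R (s ℕ.+ t) (minor (i ↑ˡ t) M))
      ≈⟨ altSum-cong (suc s) term ⟩
    altSum R (suc s) (λ i → D * (A zero i * det R s (minor i A)))
      ≈⟨ altSum-*ˡ (suc s) D (λ i → A zero i * det R s (minor i A)) ⟩
    D * det R (suc s) A ≈⟨ *-comm _ _ ⟩
    det R (suc s) A * D ∎
    where
    A : Matrix R (suc s)
    A a b = M (a ↑ˡ t) (b ↑ˡ t)
    D : Carrier
    D = det R t (λ a b → M (suc s ↑ʳ a) (suc s ↑ʳ b))
    term : ∀ i → M zero (i ↑ˡ t) * det R (s ℕ.+ t) (minor (i ↑ˡ t) M) ≈ D * (A zero i * det R s (minor i A))
    term i = begin
      M zero (i ↑ˡ t) * det R (s ℕ.+ t) (minor (i ↑ˡ t) M)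
        ≈⟨ *-congˡ (det-blockLowerTriangular s t (minor (i ↑ˡ t) M)
             (λ a b → trans (reflexive (≡.cong (M (suc a ↑ˡ t)) (punchIn-↑ʳ i b))) (upperRight≈0 (suc a) b))) ⟩
      A zero i * (det R s (λ a b → M (suc a ↑ˡ t) (punchIn (i ↑ˡ t) (b ↑ˡ t)))
                  * det R t (λ a b → M (suc s ↑ʳ a) (punchIn (i ↑ˡ t) (s ↑ʳ b))))
        ≈⟨ *-congˡ (*-cong (det-cong s (λ a b → reflexive (≡.cong (M (suc a ↑ˡ t)) (punchIn-↑ˡ i b))))
                           (det-cong t (λ a b → reflexive (≡.cong (M (suc s ↑ʳ a)) (punchIn-↑ʳ i b))))) ⟩
      A zero i * (det R s (minor i A) * D)
        ≈⟨ solve 3 (λ x y z → x :* (y :* z) := z :* (x :* y)) refl _ _ _ ⟩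
      D * (A zero i * det R s (minor i A)) ∎

  det-firstColumnZeroBelow : ∀ k (M : Matrix R (suc k)) → (∀ a → M (suc a) zero ≈ 0#) →
    det R (suc k) M ≈ M zero zero * det R k (λ a b → M (suc a) (suc b))
  det-firstColumnZeroBelow k M below≈0 = begin
    det R (suc k) M                   ≈⟨ det-transpose (suc k) M ⟨
    det R (suc k) (λ a b → M b a)     ≈⟨ det-blockLowerTriangular 1 k (λ a b → M b a) (λ { zero b → below≈0 b }) ⟩
    (M zero zero * 1# - 0#) * det R k (λ a b → M (suc b) (suc a))
      ≈⟨ *-cong (trans (+-cong (*-identityʳ _) -0#≈0#) (+-identityʳ _)) (det-transpose k _) ⟩
    M zero zero * det R k (λ a b → M (suc a) (suc b)) ∎

  det-scalar : ∀ k q → det R k (λ i j → δ i j * q) ≈ q ^ k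
  det-scalar zero q = refl
  det-scalar (suc k) q = begin
    det R (suc k) (λ i j → δ i j * q)
      ≈⟨ det-firstColumnZeroBelow k (λ i j → δ i j * q) (λ a → zeroˡ q) ⟩
    (1# * q) * det R k (λ i j → δ i j * q) ≈⟨ *-cong (*-identityˡ q) (det-scalar k q) ⟩
    q ^ suc k ∎

  det-addColumnCombination : ∀ k (M : Matrix R k) t (coeff : Fin k → Carrier) → coeff t ≈ 0# →
    det R k (setColumn M t (λ a → M a t + sumF R k (λ b → M a b * coeff b))) ≈ det R k M
  det-addColumnCombination k M t coeff coeffₜ≈0 = begin
    det R k (setColumn M t (λ a → M a t + sumF R k (λ b → M a b * coeff b)))
      ≈⟨ det-setColumn-+ k M t (λ a → M a t) (λ a → sumF R k (λ b → M a b * coeff b)) ⟩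
    det R k (setColumn M t (λ a → M a t)) + det R k (setColumn M t (λ a → sumF R k (λ b → M a b * coeff b)))
      ≈⟨ +-cong (det-cong k (λ a b → reflexive (setColumn-self M t a b)))
                (det-setColumn-sumF k M t k (λ a b → M a b * coeff b)) ⟩
    det R k M + sumF R k (λ b → det R k (setColumn M t (λ a → M a b * coeff b)))
      ≈⟨ +-congˡ (sumF-zero k (λ b → copy≈0 b (b Fin.≟ t))) ⟩
    det R k M + 0# ≈⟨ +-identityʳ _ ⟩
    det R k M ∎
    where
    copy≈0 : ∀ b → Dec (b ≡ t) → det R k (setColumn M t (λ a → M a b * coeff b)) ≈ 0#
    copy≈0 b b≟t = begin
      det R k (setColumn M t (λ a → M a b * coeff b))
        ≈⟨ det-cong k commuted ⟩
      det R k (setColumn M t (λ a → coeff b * M a b))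
        ≈⟨ det-setColumn-*ˡ k M t (coeff b) (λ a → M a b) ⟩
      coeff b * det R k (setColumn M t (λ a → M a b))
        ≈⟨ vanish b≟t ⟩
      0# ∎
      where
      commuted : ∀ a b′ → setColumn M t (λ a → M a b * coeff b) a b′ ≈ setColumn M t (λ a → coeff b * M a b) a b′
      commuted a b′ with b′ Fin.≟ t
      ... | yes _ = *-comm _ _
      ... | no _ = refl
      vanish : Dec (b ≡ t) → coeff b * det R k (setColumn M t (λ a → M a b)) ≈ 0#
      vanish (yes ≡.refl) = trans (*-congʳ coeffₜ≈0) (zeroˡ _)
      vanish (no b≢t) = trans (*-congˡ (det-equalColumns k _ (b≢t ∘ ≡.sym)
        (λ a → reflexive (≡.trans (setColumn-≡ M t _ a) (≡.sym (setColumn-≢ M t _ a b≢t)))))) (zeroʳ _)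

  private
    inFirst : ∀ {k} → ℕ → Fin k → Carrier
    inFirst t b = boolR R ⌊ toℕ b ℕ.<? t ⌋

    inFirst-0 : ∀ {k} (b : Fin k) → inFirst 0 b ≡ 0#
    inFirst-0 b with toℕ b ℕ.<? 0
    ... | no _ = ≡.refl

    inFirst-all : ∀ {k} (b : Fin k) → inFirst k b ≡ 1#
    inFirst-all {k} b with toℕ b ℕ.<? k
    ... | yes _ = ≡.refl
    ... | no b≮k = ⊥-elim (b≮k (Fin.toℕ<n b))

    inFirst-at : ∀ {k} t (b : Fin k) → toℕ b ≡ t → inFirst t b ≡ 0#
    inFirst-at t b b≡t with toℕ b ℕ.<? t
    ... | yes b<t = ⊥-elim (ℕ.<-irrefl b≡t b<t)
    ... | no _ = ≡.refl

    inFirst-suc-at : ∀ {k} t (b : Fin k) → toℕ b ≡ t → inFirst (suc t) b ≡ 1#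
    inFirst-suc-at t b b≡t with toℕ b ℕ.<? suc t
    ... | yes _ = ≡.refl
    ... | no b≮1+t = ⊥-elim (b≮1+t (ℕ.≤-reflexive (≡.cong suc b≡t)))

    inFirst-suc-≢ : ∀ {k} t (b : Fin k) → toℕ b ≢ t → inFirst (suc t) b ≡ inFirst t b
    inFirst-suc-≢ t b b≢t with toℕ b ℕ.<? suc t | toℕ b ℕ.<? t
    ... | yes _ | yes _ = ≡.refl
    ... | no _ | no _ = ≡.refl
    ... | yes b<1+t | no b≮t = ⊥-elim (b≮t (ℕ.≤∧≢⇒< (ℕ.≤-pred b<1+t) b≢t))
    ... | no b≮1+t | yes b<t = ⊥-elim (b≮1+t (ℕ.m≤n⇒m≤1+n b<t))

  -- Adding to each target column a combination of non-target columns, done one column at a time: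
  -- after the first t columns are treated, the sources are still unchanged.
  det-columnOperations : ∀ k (M : Matrix R k) (C : Fin k → Fin k → Carrier) (target : Fin k → Bool) →
    (∀ b′ b → target b′ ≡ true → C b′ b ≈ 0#) → (∀ b′ b → target b ≡ false → C b′ b ≈ 0#) →
    det R k (λ a b → M a b + sumF R k (λ b′ → M a b′ * C b′ b)) ≈ det R k M
  det-columnOperations k M C target from-target≈0 to-other≈0 = begin
    det R k (λ a b → M a b + sumF R k (λ b′ → M a b′ * C b′ b))
      ≈⟨ det-cong k (λ a b → +-congˡ (sumF-cong k (λ b′ → *-congˡ
           (trans (sym (*-identityˡ _)) (*-congʳ (reflexive (≡.sym (inFirst-all b)))))))) ⟩
    det R k (treated k) ≈⟨ det-treated k ℕ.≤-refl ⟩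
    det R k M ∎
    where
    treated : ℕ → Matrix R k
    treated t a b = M a b + sumF R k (λ b′ → M a b′ * (inFirst t b * C b′ b))
    treated-other : ∀ t a b′ → target b′ ≡ false → treated t a b′ ≈ M a b′
    treated-other t a b′ other = trans (+-congˡ (sumF-zero k (λ b″ →
      trans (*-congˡ (trans (*-congˡ (to-other≈0 b″ b′ other)) (zeroʳ _))) (zeroʳ _)))) (+-identityʳ _)
    treated-source : ∀ t a b′ b → treated t a b′ * C b′ b ≈ M a b′ * C b′ b
    treated-source t a b′ b with target b′ in eq
    ... | true = trans (*-congˡ (from-target≈0 b′ b eq)) (trans (zeroʳ _) (sym (trans (*-congˡ (from-target≈0 b′ b eq)) (zeroʳ _))))
    ... | false = *-congʳ (treated-other t a b′ eq)
    step : ∀ t → (t<k : t ℕ.< k) → det R k (treated (suc t)) ≈ det R k (treated t)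
    step t t<k = begin
      det R k (treated (suc t))
        ≈⟨ det-cong k entries ⟩
      det R k (setColumn (treated t) bₜ (λ a → treated t a bₜ + sumF R k (λ b′ → treated t a b′ * C b′ bₜ)))
        ≈⟨ det-addColumnCombination k (treated t) bₜ (λ b′ → C b′ bₜ) Cₜₜ≈0 ⟩
      det R k (treated t) ∎
      where
      bₜ : Fin k
      bₜ = Fin.fromℕ< t<k
      bₜ≡t : toℕ bₜ ≡ t
      bₜ≡t = Fin.toℕ-fromℕ< t<k
      Cₜₜ≈0 : C bₜ bₜ ≈ 0#
      Cₜₜ≈0 with target bₜ in eq
      ... | true = from-target≈0 bₜ bₜ eq
      ... | false = to-other≈0 bₜ bₜ eq
      entries : ∀ a b → treated (suc t) a b
        ≈ setColumn (treated t) bₜ (λ a → treated t a bₜ + sumF R k (λ b′ → treated t a b′ * C b′ bₜ)) a b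
      entries a b with b Fin.≟ bₜ
      ... | yes ≡.refl = begin
        M a b + sumF R k (λ b′ → M a b′ * (inFirst (suc t) b * C b′ b))
          ≈⟨ +-congˡ (sumF-cong k (λ b′ → *-congˡ (trans (*-congʳ (reflexive (inFirst-suc-at t b bₜ≡t))) (*-identityˡ _)))) ⟩
        M a b + sumF R k (λ b′ → M a b′ * C b′ b)
          ≈⟨ +-cong (trans (+-congˡ (sumF-zero k (λ b′ → trans (*-congˡ (trans (*-congʳ (reflexive (inFirst-at t b bₜ≡t))) (zeroˡ _))) (zeroʳ _)))) (+-identityʳ _))
                    (sumF-cong k (λ b′ → treated-source t a b′ b)) ⟨
        treated t a b + sumF R k (λ b′ → treated t a b′ * C b′ b) ∎
      ... | no b≢bₜ = +-congˡ (sumF-cong k (λ b′ → *-congˡ (*-congʳ (reflexive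
              (inFirst-suc-≢ t b (λ b≡t → b≢bₜ (Fin.toℕ-injective (≡.trans b≡t (≡.sym bₜ≡t)))))))))
    det-treated : ∀ t → t ℕ.≤ k → det R k (treated t) ≈ det R k M
    det-treated zero _ = det-cong k (λ a b → trans (+-congˡ (sumF-zero k (λ b′ →
      trans (*-congˡ (trans (*-congʳ (reflexive (inFirst-0 b))) (zeroˡ _))) (zeroʳ _)))) (+-identityʳ _))
    det-treated (suc t) t<k = trans (step t t<k) (det-treated t (ℕ.<⇒≤ t<k))

  det-rowOperations : ∀ k (M : Matrix R k) (C : Fin k → Fin k → Carrier) (target : Fin k → Bool) →
    (∀ a a′ → target a′ ≡ true → C a a′ ≈ 0#) → (∀ a a′ → target a ≡ false → C a a′ ≈ 0#) →
    det R k (λ a b → M a b + sumF R k (λ a′ → C a a′ * M a′ b)) ≈ det R k M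
  det-rowOperations k M C target from-target≈0 to-other≈0 = begin
    det R k (λ a b → M a b + sumF R k (λ a′ → C a a′ * M a′ b))
      ≈⟨ det-transpose k _ ⟨
    det R k (λ b a → M a b + sumF R k (λ a′ → C a a′ * M a′ b))
      ≈⟨ det-cong k (λ b a → +-congˡ (sumF-cong k (λ a′ → *-comm _ _))) ⟩
    det R k (λ b a → M a b + sumF R k (λ a′ → M a′ b * C a a′))
      ≈⟨ det-columnOperations k (λ b a → M a b) (λ a′ a → C a a′) target
           (λ a′ a → from-target≈0 a a′) (λ a′ a → to-other≈0 a a′) ⟩
    det R k (λ b a → M a b)
      ≈⟨ det-transpose k M ⟩
    det R k M ∎

  -- Block matrices

  blocks : ∀ n s → (Fin n → Fin s → Fin n → Fin s → Carrier) → Matrix R (n ℕ.* s)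
  blocks n s f r t = f (proj₁ (remQuot {n} s r)) (proj₂ (remQuot {n} s r)) (proj₁ (remQuot {n} s t)) (proj₂ (remQuot {n} s t))

  blocks-combine : ∀ n s f (v : Fin n) (u : Fin s) v′ u′ → blocks n s f (combine v u) (combine v′ u′) ≡ f v u v′ u′
  blocks-combine n s f v u v′ u′ =
    ≡.cong₂ (λ x y → f (proj₁ x) (proj₂ x) (proj₁ y) (proj₂ y)) (Fin.remQuot-combine v u) (Fin.remQuot-combine v′ u′)

  ≈-byCombine : ∀ n s {M N : Matrix R (n ℕ.* s)} →
    (∀ (v : Fin n) (u : Fin s) v′ u′ → M (combine v u) (combine v′ u′) ≈ N (combine v u) (combine v′ u′)) →
    ∀ r t → M r t ≈ N r t
  ≈-byCombine n s {M} {N} M≈N r t =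
    ∀-combine {m = n} {s} {P = λ r → M r t ≈ N r t}
      (λ v u → ∀-combine {m = n} {s} {P = λ t → M (combine v u) t ≈ N (combine v u) t} (M≈N v u) t) r

  sumF-*-combine : ∀ n s {X Y : Matrix R (n ℕ.* s)} {x y : Fin n → Fin s → Fin n → Fin s → Carrier} →
    (∀ v u v′ u′ → X (combine v u) (combine v′ u′) ≈ x v u v′ u′) →
    (∀ v u v′ u′ → Y (combine v u) (combine v′ u′) ≈ y v u v′ u′) →
    ∀ v u v′ u′ → sumF R (n ℕ.* s) (λ r → X (combine v u) r * Y r (combine v′ u′))
                    ≈ sumF R n (λ v″ → sumF R s (λ u″ → x v u v″ u″ * y v″ u″ v′ u′))
  sumF-*-combine n s {X} {Y} X≈x Y≈y v u v′ u′ =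
    trans (sumF-combine n s (λ r → X (combine v u) r * Y r (combine v′ u′)))
          (sumF-cong n (λ v″ → sumF-cong s (λ u″ → *-cong (X≈x v u v″ u″) (Y≈y v″ u″ v′ u′))))

  det-blocksLowerTriangular : ∀ n s (f : Fin (suc n) → Fin s → Fin (suc n) → Fin s → Carrier) →
    (∀ u v′ u′ → f zero u (suc v′) u′ ≈ 0#) →
    det R (suc n ℕ.* s) (blocks (suc n) s f)
      ≈ det R s (λ u u′ → f zero u zero u′) * det R (n ℕ.* s) (blocks n s (λ v u v′ u′ → f (suc v) u (suc v′) u′))
  det-blocksLowerTriangular n s f upperRight≈0 = begin
    det R (suc n ℕ.* s) (blocks (suc n) s f)
      ≈⟨ det-blockLowerTriangular s (n ℕ.* s) (blocks (suc n) s f) upperRight-blocks≈0 ⟩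
    det R s (λ u u′ → blocks (suc n) s f (u ↑ˡ (n ℕ.* s)) (u′ ↑ˡ (n ℕ.* s)))
      * det R (n ℕ.* s) (λ r t → blocks (suc n) s f (s ↑ʳ r) (s ↑ʳ t))
      ≈⟨ *-cong (det-cong s (λ u u′ → reflexive (blocks-combine (suc n) s f zero u zero u′)))
                (det-cong (n ℕ.* s) (≈-byCombine n s (λ v u v′ u′ → reflexive (≡.trans
                  (blocks-combine (suc n) s f (suc v) u (suc v′) u′)
                  (≡.sym (blocks-combine n s (λ v u v′ u′ → f (suc v) u (suc v′) u′) v u v′ u′)))))) ⟩
    det R s (λ u u′ → f zero u zero u′) * det R (n ℕ.* s) (blocks n s (λ v u v′ u′ → f (suc v) u (suc v′) u′)) ∎
    where
    upperRight-blocks≈0 : ∀ u r → blocks (suc n) s f (u ↑ˡ (n ℕ.* s)) (s ↑ʳ r) ≈ 0#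
    upperRight-blocks≈0 u = ∀-combine {m = n} {s} λ v′ u′ →
      trans (reflexive (blocks-combine (suc n) s f zero u (suc v′) u′)) (upperRight≈0 u v′ u′)

  det-blockDiagonal : ∀ n s (S : Matrix R s) → det R (n ℕ.* s) (blocks n s (λ v u v′ u′ → δ v v′ * S u u′)) ≈ det R s S ^ n
  det-blockDiagonal zero s S = refl
  det-blockDiagonal (suc n) s S = begin
    det R (suc n ℕ.* s) (blocks (suc n) s (λ v u v′ u′ → δ v v′ * S u u′))
      ≈⟨ det-blocksLowerTriangular n s (λ v u v′ u′ → δ v v′ * S u u′) (λ u v′ u′ → zeroˡ _) ⟩
    det R s (λ u u′ → 1# * S u u′) * det R (n ℕ.* s) (blocks n s (λ v u v′ u′ → δ v v′ * S u u′))
      ≈⟨ *-cong (det-cong s (λ u u′ → *-identityˡ _)) (det-blockDiagonal n s S) ⟩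
    det R s S * det R s S ^ n ∎

  atZero offZero : ∀ {n} → Fin n → Carrier
  atZero zero = 1#
  atZero (suc _) = 0#
  offZero zero = 0#
  offZero (suc _) = 1#

  isZeroᵇ : ∀ {n} → Fin n → Bool
  isZeroᵇ zero = true
  isZeroᵇ (suc _) = false

  atZero-≡0 : ∀ {n} (v : Fin n) → isZeroᵇ v ≡ false → atZero v ≡ 0#
  atZero-≡0 zero ()
  atZero-≡0 (suc _) _ = ≡.refl

  offZero-≡0 : ∀ {n} (v : Fin n) → isZeroᵇ v ≡ true → offZero v ≡ 0#
  offZero-≡0 zero _ = ≡.refl
  offZero-≡0 (suc _) ()

  sumF-atZero : ∀ n (g : Fin (suc n) → Carrier) → sumF R (suc n) (λ v → atZero v * g v) ≈ g zero
  sumF-atZero n g = trans (+-cong (*-identityˡ _) (sumF-zero n (λ _ → zeroˡ _))) (+-identityʳ _)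

  sumF-offZero : ∀ n (v′ : Fin (suc n)) x y →
    sumF R (suc n) (λ v → offZero v * (δ v v′ * x - y)) ≈ offZero v′ * x - natR R n * y
  sumF-offZero n v′ x y = begin
    sumF R (suc n) (λ v → offZero v * (δ v v′ * x - y))
      ≈⟨ sumF-cong (suc n) (λ v → solve 4 (λ o d x y → o :* (d :* x :- y) := d :* (o :* x) :+ :- (o :* y)) refl (offZero v) (δ v v′) x y) ⟩
    sumF R (suc n) (λ v → δ v v′ * (offZero v * x) + - (offZero v * y))
      ≈⟨ sumF-+ (suc n) (λ v → δ v v′ * (offZero v * x)) (λ v → - (offZero v * y)) ⟩
    sumF R (suc n) (λ v → δ v v′ * (offZero v * x)) + sumF R (suc n) (λ v → - (offZero v * y))
      ≈⟨ +-cong (sumF-δˡ (suc n) v′ (λ v → offZero v * x)) (sumF-neg (suc n) (λ v → offZero v * y)) ⟩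
    offZero v′ * x - (0# * y + sumF R n (λ _ → 1# * y))
      ≈⟨ +-congˡ (-‿cong (trans (+-cong (zeroˡ y) (sumF-const n (1# * y))) (trans (+-identityˡ _) (*-congˡ (*-identityˡ y))))) ⟩
    offZero v′ * x - natR R n * y ∎

  -- Row and column operations bring I ⊗ S − J ⊗ T to block lower-triangular form:
  -- add all block rows to the first, then subtract the first block column from the others.
  module Kronecker (n′ s : ℕ) (S T : Matrix R s) where
    n : ℕ
    n = suc n′

    w : Fin n → Fin s → Fin n → Fin s → Carrier
    w v u v′ u′ = δ v v′ * S u u′ - T u u′

    rowCoeff columnCoeff : Fin n → Fin s → Fin n → Fin s → Carrier
    rowCoeff v u v″ u″ = atZero v * (offZero v″ * δ u u″)
    columnCoeff v″ u″ v′ u′ = - (atZero v″ * (offZero v′ * δ u″ u′))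

    W₁ : Matrix R (n ℕ.* s)
    W₁ r t = blocks n s w r t + sumF R (n ℕ.* s) (λ r′ → blocks n s rowCoeff r r′ * blocks n s w r′ t)

    w₁ : Fin n → Fin s → Fin n → Fin s → Carrier
    w₁ v u v′ u′ = w v u v′ u′ + atZero v * (offZero v′ * S u u′ - natR R n′ * T u u′)

    W₂ : Matrix R (n ℕ.* s)
    W₂ r t = W₁ r t + sumF R (n ℕ.* s) (λ t′ → W₁ r t′ * blocks n s columnCoeff t′ t)

    w₂ : Fin n → Fin s → Fin n → Fin s → Carrier
    w₂ v u v′ u′ = w₁ v u v′ u′ - offZero v′ * w₁ v u zero u′

    blocks≈ : ∀ f v u v′ u′ → blocks n s f (combine v u) (combine v′ u′) ≈ f v u v′ u′
    blocks≈ f v u v′ u′ = reflexive (blocks-combine n s f v u v′ u′)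

    W₁-combine : ∀ v u v′ u′ → W₁ (combine v u) (combine v′ u′) ≈ w₁ v u v′ u′
    W₁-combine v u v′ u′ = +-cong (blocks≈ w v u v′ u′) (begin
      sumF R (n ℕ.* s) (λ r′ → blocks n s rowCoeff (combine v u) r′ * blocks n s w r′ (combine v′ u′))
        ≈⟨ sumF-*-combine n s {blocks n s rowCoeff} {blocks n s w} (blocks≈ rowCoeff) (blocks≈ w) v u v′ u′ ⟩
      sumF R n (λ v″ → sumF R s (λ u″ → (atZero v * (offZero v″ * δ u u″)) * w v″ u″ v′ u′))
        ≈⟨ sumF-cong n (λ v″ → trans (sumF-cong s (λ u″ → reassoc (atZero v) (offZero v″) (δ u u″) (w v″ u″ v′ u′)))
                                      (trans (sumF-*ˡ s _ _) (trans (*-congˡ (sumF-δʳ s u (λ u″ → w v″ u″ v′ u′))) (*-assoc _ _ _)))) ⟩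
      sumF R n (λ v″ → atZero v * (offZero v″ * w v″ u v′ u′))
        ≈⟨ sumF-*ˡ n (atZero v) (λ v″ → offZero v″ * w v″ u v′ u′) ⟩
      atZero v * sumF R n (λ v″ → offZero v″ * w v″ u v′ u′)
        ≈⟨ *-congˡ (sumF-offZero n′ v′ (S u u′) (T u u′)) ⟩
      atZero v * (offZero v′ * S u u′ - natR R n′ * T u u′) ∎)
      where
      reassoc : ∀ a b d x → (a * (b * d)) * x ≈ (a * b) * (d * x)
      reassoc = solve 4 (λ a b d x → (a :* (b :* d)) :* x := (a :* b) :* (d :* x)) refl

    W₂-combine : ∀ v u v′ u′ → W₂ (combine v u) (combine v′ u′) ≈ w₂ v u v′ u′
    W₂-combine v u v′ u′ = +-cong (W₁-combine v u v′ u′) (begin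
      sumF R (n ℕ.* s) (λ t′ → W₁ (combine v u) t′ * blocks n s columnCoeff t′ (combine v′ u′))
        ≈⟨ sumF-*-combine n s {W₁} {blocks n s columnCoeff} W₁-combine (blocks≈ columnCoeff) v u v′ u′ ⟩
      sumF R n (λ v″ → sumF R s (λ u″ → w₁ v u v″ u″ * - (atZero v″ * (offZero v′ * δ u″ u′))))
        ≈⟨ sumF-cong n (λ v″ → trans (sumF-cong s (λ u″ → reassoc (w₁ v u v″ u″) (atZero v″) (offZero v′) (δ u″ u′)))
                                      (sumF-δˡ s u′ (λ u″ → atZero v″ * (- offZero v′ * w₁ v u v″ u″)))) ⟩
      sumF R n (λ v″ → atZero v″ * (- offZero v′ * w₁ v u v″ u′))
        ≈⟨ sumF-atZero n′ (λ v″ → - offZero v′ * w₁ v u v″ u′) ⟩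
      - offZero v′ * w₁ v u zero u′ ≈⟨ -‿distribˡ-* _ _ ⟨
      - (offZero v′ * w₁ v u zero u′) ∎)
      where
      reassoc : ∀ x a b d → x * - (a * (b * d)) ≈ d * (a * (- b * x))
      reassoc = solve 4 (λ x a b d → x :* :- (a :* (b :* d)) := d :* (a :* (:- b :* x))) refl

    w₂-topLeft : ∀ u u′ → w₂ zero u zero u′ ≈ S u u′ - natR R n * T u u′
    w₂-topLeft u u′ = solve 3 (λ x t k →
      ((con (+ 1) :* x :- t) :+ con (+ 1) :* (con (+ 0) :* x :- k :* t))
        :- con (+ 0) :* ((con (+ 1) :* x :- t) :+ con (+ 1) :* (con (+ 0) :* x :- k :* t))
      := x :- (con (+ 1) :+ k) :* t) refl (S u u′) (T u u′) (natR R n′)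

    w₂-topRight : ∀ u v′ u′ → w₂ zero u (suc v′) u′ ≈ 0#
    w₂-topRight u v′ u′ = solve 3 (λ x t k →
      ((con (+ 0) :* x :- t) :+ con (+ 1) :* (con (+ 1) :* x :- k :* t))
        :- con (+ 1) :* ((con (+ 1) :* x :- t) :+ con (+ 1) :* (con (+ 0) :* x :- k :* t))
      := con (+ 0)) refl (S u u′) (T u u′) (natR R n′)

    w₂-bottomRight : ∀ v u v′ u′ → w₂ (suc v) u (suc v′) u′ ≈ δ v v′ * S u u′
    w₂-bottomRight v u v′ u′ = solve 4 (λ e x t k →
      ((e :* x :- t) :+ con (+ 0) :* (con (+ 1) :* x :- k :* t))
        :- con (+ 1) :* ((con (+ 0) :* x :- t) :+ con (+ 0) :* (con (+ 0) :* x :- k :* t))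
      := e :* x) refl (δ v v′) (S u u′) (T u u′) (natR R n′)

  det-kronecker : ∀ n′ s (S T : Matrix R s) →
    det R (suc n′ ℕ.* s) (blocks (suc n′) s (λ v u v′ u′ → δ v v′ * S u u′ - T u u′))
      ≈ det R s (λ u u′ → S u u′ - natR R (suc n′) * T u u′) * det R s S ^ n′
  det-kronecker n′ s S T = begin
    det R N (blocks n s w)
      ≈⟨ det-rowOperations N (blocks n s w) (blocks n s rowCoeff) (isZeroᵇ ∘ block)
           (λ r r′ r′∈0 → trans (*-congˡ (trans (*-congʳ (reflexive (offZero-≡0 (block r′) r′∈0))) (zeroˡ _))) (zeroʳ _))
           (λ r r′ r∉0 → trans (*-congʳ (reflexive (atZero-≡0 (block r) r∉0))) (zeroˡ _)) ⟨
    det R N W₁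
      ≈⟨ det-columnOperations N W₁ (blocks n s columnCoeff) (not ∘ isZeroᵇ ∘ block)
           (λ t′ t t′∉0 → trans (-‿cong (trans (*-congʳ (reflexive (atZero-≡0 (block t′) (not-injective t′∉0)))) (zeroˡ _))) -0#≈0#)
           (λ t′ t t∈0 → trans (-‿cong (trans (*-congˡ (trans (*-congʳ (reflexive (offZero-≡0 (block t) (not-injective t∈0)))) (zeroˡ _))) (zeroʳ _))) -0#≈0#) ⟨
    det R N W₂
      ≈⟨ det-cong N (≈-byCombine n s (λ v u v′ u′ → trans (W₂-combine v u v′ u′) (sym (blocks≈ w₂ v u v′ u′)))) ⟩
    det R N (blocks n s w₂)
      ≈⟨ det-blocksLowerTriangular n′ s w₂ w₂-topRight ⟩
    det R s (λ u u′ → w₂ zero u zero u′) * det R (n′ ℕ.* s) (blocks n′ s (λ v u v′ u′ → w₂ (suc v) u (suc v′) u′))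
      ≈⟨ *-cong (det-cong s w₂-topLeft)
                (trans (det-cong (n′ ℕ.* s) (≈-byCombine n′ s (λ v u v′ u′ →
                          trans (reflexive (blocks-combine n′ s (λ v u v′ u′ → w₂ (suc v) u (suc v′) u′) v u v′ u′))
                          (trans (w₂-bottomRight v u v′ u′) (sym (reflexive (blocks-combine n′ s (λ v u v′ u′ → δ v v′ * S u u′) v u v′ u′)))))))
                       (det-blockDiagonal n′ s S)) ⟩
    det R s (λ u u′ → S u u′ - natR R (suc n′) * T u u′) * det R s S ^ n′ ∎
    where
    open Kronecker n′ s S T
    N : ℕ
    N = n ℕ.* s
    block : Fin N → Fin n
    block r = proj₁ (remQuot {n} s r)

  -- Arrowhead matrices

  arrowhead : ∀ m → Carrier → Carrier → Matrix R (suc m)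
  arrowhead m p q zero    zero    = p
  arrowhead m p q zero    (suc j) = - 1#
  arrowhead m p q (suc i) zero    = - 1#
  arrowhead m p q (suc i) (suc j) = δ i j * q

  det-swap01 : ∀ m (M : Matrix R (suc (suc m))) → det R (suc (suc m)) (λ a b → M (swap01 a) (swap01 b)) ≈ det R (suc (suc m)) M
  det-swap01 m = det-reindex ≡.refl swap01 swap01 swap01-involutive swap01-involutive

  -- Split column 1 as q · e₁ + (−e₀): the first part leaves the smaller arrowhead matrix,
  -- the second a scalar matrix of size m up to sign.
  det-arrowhead-step : ∀ m p q → det R (suc (suc m)) (arrowhead (suc m) p q) ≈ q * det R (suc m) (arrowhead m p q) - q ^ m
  det-arrowhead-step m p q = begin
    det R (suc (suc m)) M
      ≈⟨ det-linearAt (suc (suc m)) (suc zero) q 1# X≈M Y≈M column₁ ⟩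
    q * det R (suc (suc m)) X + 1# * det R (suc (suc m)) Y
      ≈⟨ +-cong (*-congˡ det-X) (trans (*-identityˡ _) det-Y) ⟩
    q * det R (suc m) (arrowhead m p q) - q ^ m ∎
    where
    M X Y : Matrix R (suc (suc m))
    M = arrowhead (suc m) p q
    X zero          (suc zero)    = 0#
    X (suc i)       (suc zero)    = δ i zero
    X a             b             = M a b
    Y zero          (suc zero)    = - 1#
    Y (suc i)       (suc zero)    = 0#
    Y a             b             = M a b
    X≈M : ∀ a b → b ≢ suc zero → X a b ≈ M a b
    X≈M zero zero _ = refl
    X≈M zero (suc zero) b≢1 = ⊥-elim (b≢1 ≡.refl)
    X≈M zero (suc (suc j)) _ = refl
    X≈M (suc i) zero _ = refl
    X≈M (suc i) (suc zero) b≢1 = ⊥-elim (b≢1 ≡.refl)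
    X≈M (suc i) (suc (suc j)) _ = refl
    Y≈M : ∀ a b → b ≢ suc zero → Y a b ≈ M a b
    Y≈M zero zero _ = refl
    Y≈M zero (suc zero) b≢1 = ⊥-elim (b≢1 ≡.refl)
    Y≈M zero (suc (suc j)) _ = refl
    Y≈M (suc i) zero _ = refl
    Y≈M (suc i) (suc zero) b≢1 = ⊥-elim (b≢1 ≡.refl)
    Y≈M (suc i) (suc (suc j)) _ = refl
    column₁ : ∀ a → M a (suc zero) ≈ q * X a (suc zero) + 1# * Y a (suc zero)
    column₁ zero = solve 1 (λ q → :- con (+ 1) := q :* con (+ 0) :+ con (+ 1) :* :- con (+ 1)) refl q
    column₁ (suc i) = solve 2 (λ d q → d :* q := q :* d :+ con (+ 1) :* con (+ 0)) refl (δ i zero) q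
    det-X : det R (suc (suc m)) X ≈ det R (suc m) (arrowhead m p q)
    det-X = begin
      det R (suc (suc m)) X                                   ≈⟨ det-swap01 m X ⟨
      det R (suc (suc m)) (λ a b → X (swap01 a) (swap01 b))
        ≈⟨ det-firstColumnZeroBelow (suc m) (λ a b → X (swap01 a) (swap01 b)) (λ { zero → refl ; (suc a) → refl }) ⟩
      1# * det R (suc m) (λ a b → X (swap01 (suc a)) (swap01 (suc b)))
        ≈⟨ trans (*-identityˡ _) (det-cong (suc m) {λ a b → X (swap01 (suc a)) (swap01 (suc b))} {arrowhead m p q}
             (λ { zero zero → refl ; zero (suc b) → refl ; (suc a) zero → refl ; (suc a) (suc b) → refl })) ⟩
      det R (suc m) (arrowhead m p q) ∎
    Y′ : Matrix R (suc (suc m))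
    Y′ a b = Y (swap01 a) (swap01 b)
    det-Y : det R (suc (suc m)) Y ≈ - q ^ m
    det-Y = begin
      det R (suc (suc m)) Y   ≈⟨ det-swap01 m Y ⟨
      det R (suc (suc m)) Y′
        ≈⟨ +-cong (zeroˡ _) (-‿cong (+-congˡ (-‿cong (altSum-zero m (λ j → trans (*-congʳ (zeroˡ q)) (zeroˡ _)))))) ⟩
      0# - (- 1# * det R (suc m) (minor (suc zero) Y′) - 0#)
        ≈⟨ solve 1 (λ x → con (+ 0) :- (:- con (+ 1) :* x :- con (+ 0)) := x) refl _ ⟩
      det R (suc m) (minor (suc zero) Y′)
        ≈⟨ det-firstColumnZeroBelow m (minor (suc zero) Y′) (λ { zero → refl ; (suc a) → refl }) ⟩
      - 1# * det R m (λ i j → δ i j * q)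
        ≈⟨ *-congˡ (det-scalar m q) ⟩
      - 1# * q ^ m
        ≈⟨ solve 1 (λ x → :- con (+ 1) :* x := :- x) refl _ ⟩
      - q ^ m ∎

  det-arrowhead : ∀ m p q → det R (suc (suc m)) (arrowhead (suc m) p q) ≈ q ^ m * (q * p - natR R (suc m))
  det-arrowhead zero p q = begin
    det R 2 (arrowhead 1 p q)      ≈⟨ det-arrowhead-step zero p q ⟩
    q * (p * 1# - 0#) - 1#         ≈⟨ solve 2 (λ p q → q :* (p :* con (+ 1) :- con (+ 0)) :- con (+ 1)
                                                  := con (+ 1) :* (q :* p :- (con (+ 1) :+ con (+ 0)))) refl p q ⟩
    1# * (q * p - (1# + 0#))       ∎
  det-arrowhead (suc m) p q = begin
    det R (suc (suc (suc m))) (arrowhead (suc (suc m)) p q)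
      ≈⟨ det-arrowhead-step (suc m) p q ⟩
    q * det R (suc (suc m)) (arrowhead (suc m) p q) - q ^ suc m
      ≈⟨ +-congʳ (*-congˡ (det-arrowhead m p q)) ⟩
    q * (q ^ m * (q * p - natR R (suc m))) - q * q ^ m
      ≈⟨ solve 4 (λ q x p k → q :* (x :* (q :* p :- k)) :- q :* x := (q :* x) :* (q :* p :- (con (+ 1) :+ k))) refl q (q ^ m) p (natR R (suc m)) ⟩
    q ^ suc m * (q * p - natR R (suc (suc m))) ∎

  -- Graph bundles with complete fibre

  boolR-∧ : ∀ x y → boolR R (x ∧ y) ≈ boolR R x * boolR R y
  boolR-∧ true y = sym (*-identityˡ _)
  boolR-∧ false y = sym (zeroˡ _)

  boolR-not : ∀ x → boolR R (not x) ≈ 1# - boolR R x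
  boolR-not true = sym (-‿inverseʳ 1#)
  boolR-not false = sym (trans (+-congˡ -0#≈0#) (+-identityʳ 1#))

  boolR-∨-disjoint : ∀ x y → (x ≡ true → y ≡ false) → boolR R (x ∨ y) ≈ boolR R x + boolR R y
  boolR-∨-disjoint true y x⇒¬y rewrite x⇒¬y ≡.refl = sym (+-identityʳ 1#)
  boolR-∨-disjoint false y _ = sym (+-identityˡ _)

  δ-⟨$⟩ʳ : ∀ {n} (π : Permutation′ n) w w′ → δ w′ (π ⟨$⟩ʳ w) ≡ δ w (π ⟨$⟩ˡ w′)
  δ-⟨$⟩ʳ π w w′ with w′ Fin.≟ π ⟨$⟩ʳ w
  ... | yes ≡.refl = ≡.trans (δ-refl (π ⟨$⟩ʳ w)) (≡.sym (≡.trans (≡.cong (δ w) (inverseˡ π)) (δ-refl w)))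
  ... | no w′≢πw = ≡.trans (δ-≢ w′≢πw) (≡.sym (δ-≢ (λ w≡ → w′≢πw (≡.trans (≡.sym (inverseʳ π)) (≡.cong (π ⟨$⟩ʳ_) (≡.sym w≡))))))

  δ-⟨$⟩ˡ : ∀ {n} (π : Permutation′ n) w w′ → δ (π ⟨$⟩ˡ w) (π ⟨$⟩ˡ w′) ≡ δ w w′
  δ-⟨$⟩ˡ π w w′ with w Fin.≟ w′
  ... | yes ≡.refl = ≡.trans (δ-refl (π ⟨$⟩ˡ w)) (≡.sym (δ-refl w))
  ... | no w≢w′ = ≡.trans (δ-≢ (λ eq → w≢w′ (≡.trans (≡.sym (inverseʳ π)) (≡.trans (≡.cong (π ⟨$⟩ʳ_) eq) (inverseʳ π)))))
                          (≡.sym (δ-≢ w≢w′))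

  module _ (G : Graph) (n′ : ℕ) (φ : Voltage G (complete (suc n′))) (loopless : ∀ u → adj G u u ≡ false) where
    private
      n : ℕ
      n = suc n′
      X : Graph
      X = bundle G (complete n) φ

    adj-bundle : ∀ u w u′ w′ → boolR R (adj X (combine u w) (combine u′ w′))
                                ≈ boolR R (adj G u u′) * δ w′ (φ u u′ ⟨$⟩ʳ w) + δ u u′ * (1# - δ w w′)
    adj-bundle u w u′ w′ = begin
      boolR R (adj X (combine u w) (combine u′ w′))
        ≡⟨ ≡.cong₂ (λ x y → boolR R ((adj G (proj₁ x) (proj₁ y) ∧ ⌊ proj₂ y Fin.≟ (φ (proj₁ x) (proj₁ y) ⟨$⟩ʳ proj₂ x) ⌋)
                                     ∨ (⌊ proj₁ x Fin.≟ proj₁ y ⌋ ∧ not ⌊ proj₂ x Fin.≟ proj₂ y ⌋)))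
                   (Fin.remQuot-combine u w) (Fin.remQuot-combine u′ w′) ⟩
      boolR R ((adj G u u′ ∧ ⌊ w′ Fin.≟ (φ u u′ ⟨$⟩ʳ w) ⌋) ∨ (⌊ u Fin.≟ u′ ⌋ ∧ not ⌊ w Fin.≟ w′ ⌋))
        ≈⟨ boolR-∨-disjoint (adj G u u′ ∧ _) (⌊ u Fin.≟ u′ ⌋ ∧ _) edge⇒¬same ⟩
      boolR R (adj G u u′ ∧ ⌊ w′ Fin.≟ (φ u u′ ⟨$⟩ʳ w) ⌋) + boolR R (⌊ u Fin.≟ u′ ⌋ ∧ not ⌊ w Fin.≟ w′ ⌋)
        ≈⟨ +-cong (boolR-∧ (adj G u u′) _) (boolR-∧ ⌊ u Fin.≟ u′ ⌋ _) ⟩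
      boolR R (adj G u u′) * boolR R ⌊ w′ Fin.≟ (φ u u′ ⟨$⟩ʳ w) ⌋ + boolR R ⌊ u Fin.≟ u′ ⌋ * boolR R (not ⌊ w Fin.≟ w′ ⌋)
        ≈⟨ +-cong (*-congˡ (reflexive (boolR-≟ w′ _)))
                  (*-cong (reflexive (boolR-≟ u u′)) (trans (boolR-not ⌊ w Fin.≟ w′ ⌋) (+-congˡ (-‿cong (reflexive (boolR-≟ w w′)))))) ⟩
      boolR R (adj G u u′) * δ w′ (φ u u′ ⟨$⟩ʳ w) + δ u u′ * (1# - δ w w′) ∎
      where
      edge⇒¬same : ∀ {y z} → (adj G u u′ ∧ y) ≡ true → (⌊ u Fin.≟ u′ ⌋ ∧ z) ≡ false
      edge⇒¬same {y} edge with u Fin.≟ u′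
      ... | no _ = ≡.refl
      ... | yes ≡.refl with () ← ≡.trans (≡.sym (≡.cong (_∧ y) (loopless u))) edge

    degR-bundle : ∀ u w → degR R X (combine u w) ≈ degR R G u + natR R n′
    degR-bundle u w = begin
      sumF R (nV G ℕ.* n) (λ r → boolR R (adj X (combine u w) r))
        ≈⟨ sumF-combine (nV G) n (λ r → boolR R (adj X (combine u w) r)) ⟩
      sumF R (nV G) (λ u′ → sumF R n (λ w′ → boolR R (adj X (combine u w) (combine u′ w′))))
        ≈⟨ sumF-cong (nV G) (λ u′ → trans (sumF-cong n (adj-bundle u w u′)) (fibre-sum u′)) ⟩
      sumF R (nV G) (λ u′ → boolR R (adj G u u′) + δ u u′ * natR R n′)
        ≈⟨ sumF-+ (nV G) (λ u′ → boolR R (adj G u u′)) (λ u′ → δ u u′ * natR R n′) ⟩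
      degR R G u + sumF R (nV G) (λ u′ → δ u u′ * natR R n′)
        ≈⟨ +-congˡ (sumF-δʳ (nV G) u (λ _ → natR R n′)) ⟩
      degR R G u + natR R n′ ∎
      where
      fibre-sum : ∀ u′ → sumF R n (λ w′ → boolR R (adj G u u′) * δ w′ (φ u u′ ⟨$⟩ʳ w) + δ u u′ * (1# - δ w w′))
                          ≈ boolR R (adj G u u′) + δ u u′ * natR R n′
      fibre-sum u′ = begin
        sumF R n (λ w′ → a * δ w′ (φ u u′ ⟨$⟩ʳ w) + d * (1# - δ w w′))
          ≈⟨ sumF-+ n (λ w′ → a * δ w′ (φ u u′ ⟨$⟩ʳ w)) (λ w′ → d * (1# - δ w w′)) ⟩
        sumF R n (λ w′ → a * δ w′ (φ u u′ ⟨$⟩ʳ w)) + sumF R n (λ w′ → d * (1# - δ w w′))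
          ≈⟨ +-cong (trans (sumF-*ˡ n a (λ w′ → δ w′ (φ u u′ ⟨$⟩ʳ w))) (*-congˡ one-neighbour))
                    (trans (sumF-*ˡ n d (λ w′ → 1# - δ w w′)) (*-congˡ other-vertices)) ⟩
        a * 1# + d * (natR R n * 1# - 1#)
          ≈⟨ solve 3 (λ a d k → a :* con (+ 1) :+ d :* ((con (+ 1) :+ k) :* con (+ 1) :- con (+ 1)) := a :+ d :* k) refl a d (natR R n′) ⟩
        a + d * natR R n′ ∎
        where
        a d : Carrier
        a = boolR R (adj G u u′)
        d = δ u u′
        one-neighbour : sumF R n (λ w′ → δ w′ (φ u u′ ⟨$⟩ʳ w)) ≈ 1#
        one-neighbour = trans (sumF-cong n {g = λ w′ → δ w′ (φ u u′ ⟨$⟩ʳ w) * 1#} (λ w′ → sym (*-identityʳ _)))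
                              (sumF-δˡ n (φ u u′ ⟨$⟩ʳ w) (λ _ → 1#))
        other-vertices : sumF R n (λ w′ → 1# - δ w w′) ≈ natR R n * 1# - 1#
        other-vertices = trans (sumF-+ n (λ _ → 1#) (λ w′ → - δ w w′)) (+-cong (sumF-const n 1#)
          (trans (sumF-neg n (δ w)) (-‿cong (trans (sumF-cong n {g = λ w′ → δ w w′ * 1#} (λ w′ → sym (*-identityʳ _)))
                                                    (sumF-δʳ n w (λ _ → 1#))))))

    charMat-bundle : ∀ lam mu u w u′ w′ →
      charMat R X lam mu (combine u w) (combine u′ w′)
        ≈ δ u u′ * (δ w w′ * (lam + degR R X (combine u w) * mu + 1#) - 1#) - boolR R (adj G u u′) * δ w′ (φ u u′ ⟨$⟩ʳ w)
    charMat-bundle lam mu u w u′ w′ = begin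
      charMat R X lam mu (combine u w) (combine u′ w′)
        ≈⟨ +-cong (*-congʳ same-vertex) (-‿cong (+-cong (adj-bundle u w u′ w′) (-‿cong (*-congʳ same-vertex)))) ⟩
      (δ u u′ * δ w w′) * lam - ((a * e + δ u u′ * (1# - δ w w′)) - (δ u u′ * δ w w′) * (mu * D))
        ≈⟨ solve 7 (λ du dw a e l μ D →
             (du :* dw) :* l :- ((a :* e :+ du :* (con (+ 1) :- dw)) :- (du :* dw) :* (μ :* D))
             := du :* (dw :* (l :+ D :* μ :+ con (+ 1)) :- con (+ 1)) :- a :* e) refl (δ u u′) (δ w w′) a e lam mu D ⟩
      δ u u′ * (δ w w′ * (lam + D * mu + 1#) - 1#) - a * e ∎
      where
      a e D : Carrier
      a = boolR R (adj G u u′)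
      e = δ w′ (φ u u′ ⟨$⟩ʳ w)
      D = degR R X (combine u w)
      same-vertex : boolR R ⌊ combine u w Fin.≟ combine u′ w′ ⌋ ≈ δ u u′ * δ w w′
      same-vertex = trans (reflexive (boolR-≟ (combine u w) (combine u′ w′))) (δ-combine u u′ w w′)

  ^R≡^ : ∀ x k → _^R_ R x k ≡ x ^ k
  ^R≡^ x zero = ≡.refl
  ^R≡^ x (suc k) = ≡.cong (x *_) (^R≡^ x k)

  natR-+ : ∀ a b → natR R (a ℕ.+ b) ≈ natR R a + natR R b
  natR-+ zero b = sym (+-identityˡ _)
  natR-+ (suc a) b = trans (+-congˡ (natR-+ a b)) (sym (+-assoc _ _ _))

  star-loopless : ∀ m u → adj (star m) u u ≡ false
  star-loopless m zero = ≡.refl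
  star-loopless m (suc u) = ≡.refl

  degR-star-centre : ∀ m → degR R (star m) zero ≈ natR R m
  degR-star-centre m = trans (+-identityˡ _) (trans (sumF-const m 1#) (*-identityʳ _))

  degR-star-leaf : ∀ m (i : Fin m) → degR R (star m) (suc i) ≈ 1#
  degR-star-leaf m i = trans (+-congˡ (sumF-zero m (λ _ → refl))) (+-identityʳ 1#)

  module StarBundle (m′ n′ : ℕ) (φ : Voltage (star (suc m′)) (complete (suc n′)))
                    (isVoltage : IsVoltageAssignment (star (suc m′)) (complete (suc n′)) φ) (lam mu : Carrier) where
    m n s : ℕ
    m = suc m′
    n = suc n′
    s = suc m

    X : Graph
    X = bundle (star m) (complete n) φ

    -- Relabelling the fibre over u by untwist u makes every edge of the star carry the identity voltage.
    untwist : Fin s → Permutation′ n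
    untwist zero = Perm.id
    untwist (suc i) = φ zero (suc i)

    star-untwist : ∀ {u u′} → adj (star m) u u′ ≡ true → ∀ w w′ →
      δ w′ (φ u u′ ⟨$⟩ʳ w) ≡ δ (untwist u ⟨$⟩ˡ w) (untwist u′ ⟨$⟩ˡ w′)
    star-untwist {zero} {suc j} _ w w′ = δ-⟨$⟩ʳ (φ zero (suc j)) w w′
    star-untwist {suc i} {zero} _ w w′ =
      ≡.trans (≡.cong (δ w′) (IsVoltageAssignment.inv isVoltage zero (suc i) ≡.refl w)) (δ-sym w′ _)

    reorder : Fin (s ℕ.* n) → Fin (n ℕ.* s)
    reorder r = uncurry (λ u w → combine (untwist u ⟨$⟩ˡ w) u) (remQuot {s} n r)

    reorder⁻¹ : Fin (n ℕ.* s) → Fin (s ℕ.* n)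
    reorder⁻¹ r = uncurry (λ v u → combine u (untwist u ⟨$⟩ʳ v)) (remQuot {n} s r)

    reorder-combine : ∀ u w → reorder (combine u w) ≡ combine (untwist u ⟨$⟩ˡ w) u
    reorder-combine u w = ≡.cong (uncurry (λ u w → combine (untwist u ⟨$⟩ˡ w) u)) (Fin.remQuot-combine u w)

    reorder⁻¹-combine : ∀ v u → reorder⁻¹ (combine v u) ≡ combine u (untwist u ⟨$⟩ʳ v)
    reorder⁻¹-combine v u = ≡.cong (uncurry (λ v u → combine u (untwist u ⟨$⟩ʳ v))) (Fin.remQuot-combine v u)

    reorder-inverseˡ : ∀ r → reorder (reorder⁻¹ r) ≡ r
    reorder-inverseˡ = ∀-combine {m = n} {s} λ v u →
      ≡.trans (≡.cong reorder (reorder⁻¹-combine v u))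
              (≡.trans (reorder-combine u _) (≡.cong (λ v → combine v u) (inverseˡ (untwist u))))

    reorder-inverseʳ : ∀ r → reorder⁻¹ (reorder r) ≡ r
    reorder-inverseʳ = ∀-combine {m = s} {n} λ u w →
      ≡.trans (≡.cong reorder⁻¹ (reorder-combine u w))
              (≡.trans (reorder⁻¹-combine _ u) (≡.cong (combine u) (inverseʳ (untwist u))))

    degree : Fin s → ℕ
    degree zero = (m ℕ.+ n) ∸ 1
    degree (suc _) = n

    degR-X : ∀ (u : Fin s) (w : Fin n) → degR R X (combine u w) ≈ natR R (degree u)
    degR-X zero w = begin
      degR R X (combine {s} {n} zero w) ≈⟨ degR-bundle (star m) n′ φ (star-loopless m) zero w ⟩
      degR R (star m) zero + natR R n′ ≈⟨ +-congʳ (degR-star-centre m) ⟩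
      natR R m + natR R n′        ≈⟨ natR-+ m n′ ⟨
      natR R (m ℕ.+ n′)           ≡⟨ ≡.cong (natR R) (ℕ.+-suc m′ n′) ⟨
      natR R (degree zero)        ∎
    degR-X (suc i) w = trans (degR-bundle (star m) n′ φ (star-loopless m) (suc i) w) (+-congʳ (degR-star-leaf m i))

    weight : Fin s → Carrier
    weight u = lam + natR R (degree u) * mu + 1#

    S : Matrix R s
    S = arrowhead m (weight zero) (weight (suc zero))

    S≈weight-adj : ∀ u u′ → S u u′ ≈ δ u u′ * weight u - boolR R (adj (star m) u u′)
    S≈weight-adj zero zero = solve 1 (λ c → c := con (+ 1) :* c :- con (+ 0)) refl (weight zero)
    S≈weight-adj zero (suc j) = solve 1 (λ c → :- con (+ 1) := con (+ 0) :* c :- con (+ 1)) refl (weight zero)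
    S≈weight-adj (suc i) zero = solve 1 (λ c → :- con (+ 1) := con (+ 0) :* c :- con (+ 1)) refl (weight (suc i))
    S≈weight-adj (suc i) (suc j) = solve 2 (λ d c → d :* c := d :* c :- con (+ 0)) refl (δ i j) (weight (suc i))

    untwisted : Matrix R (n ℕ.* s)
    untwisted = blocks n s (λ v u v′ u′ → δ v v′ * S u u′ - δ u u′)

    charMat-X≈untwisted : ∀ (u : Fin s) (w : Fin n) u′ w′ →
      charMat R X lam mu (combine u w) (combine u′ w′) ≈ untwisted (reorder (combine u w)) (reorder (combine u′ w′))
    charMat-X≈untwisted u w u′ w′ = begin
      charMat R X lam mu (combine u w) (combine u′ w′)
        ≈⟨ charMat-bundle (star m) n′ φ (star-loopless m) lam mu u w u′ w′ ⟩
      δ u u′ * (δ w w′ * (lam + degR R X (combine u w) * mu + 1#) - 1#) - a * δ w′ (φ u u′ ⟨$⟩ʳ w)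
        ≈⟨ +-congʳ (*-congˡ (+-congʳ (*-congˡ (+-congʳ (+-congˡ (*-congʳ (degR-X u w))))))) ⟩
      δ u u′ * (δ w w′ * weight u - 1#) - a * δ w′ (φ u u′ ⟨$⟩ʳ w)
        ≈⟨ untwist-entry (u Fin.≟ u′) ⟩
      δ ŵ ŵ′ * (δ u u′ * weight u - a) - δ u u′
        ≈⟨ +-congʳ (*-congˡ (S≈weight-adj u u′)) ⟨
      δ ŵ ŵ′ * S u u′ - δ u u′
        ≡⟨ ≡.sym (≡.trans (≡.cong₂ untwisted (reorder-combine u w) (reorder-combine u′ w′))
                          (blocks-combine n s (λ v u v′ u′ → δ v v′ * S u u′ - δ u u′) ŵ u ŵ′ u′)) ⟩
      untwisted (reorder (combine u w)) (reorder (combine u′ w′)) ∎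
      where
      a : Carrier
      a = boolR R (adj (star m) u u′)
      ŵ ŵ′ : Fin n
      ŵ = untwist u ⟨$⟩ˡ w
      ŵ′ = untwist u′ ⟨$⟩ˡ w′
      along-edge : a * δ w′ (φ u u′ ⟨$⟩ʳ w) ≈ a * δ ŵ ŵ′
      along-edge with adj (star m) u u′ in edge
      ... | true = *-congˡ (reflexive (star-untwist edge w w′))
      ... | false = trans (zeroˡ _) (sym (zeroˡ _))
      untwist-entry : Dec (u ≡ u′) →
        δ u u′ * (δ w w′ * weight u - 1#) - a * δ w′ (φ u u′ ⟨$⟩ʳ w) ≈ δ ŵ ŵ′ * (δ u u′ * weight u - a) - δ u u′
      untwist-entry (yes ≡.refl) rewrite δ-refl u | star-loopless m u | δ-⟨$⟩ˡ (untwist u) w w′ =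
        solve 3 (λ x c e → con (+ 1) :* (x :* c :- con (+ 1)) :- con (+ 0) :* e := x :* (con (+ 1) :* c :- con (+ 0)) :- con (+ 1))
          refl (δ w w′) (weight u) (δ w′ (φ u u ⟨$⟩ʳ w))
      untwist-entry (no u≢u′) rewrite δ-≢ u≢u′ = begin
        0# * (δ w w′ * weight u - 1#) - a * δ w′ (φ u u′ ⟨$⟩ʳ w) ≈⟨ +-cong (zeroˡ _) (-‿cong along-edge) ⟩
        0# - a * δ ŵ ŵ′                                     ≈⟨ solve 3 (λ a y c → con (+ 0) :- a :* y := y :* (con (+ 0) :* c :- a) :- con (+ 0)) refl a (δ ŵ ŵ′) (weight u) ⟩
        δ ŵ ŵ′ * (0# * weight u - a) - 0#                   ∎

    det-charMat : F R X lam mu ≈ det R (n ℕ.* s) untwisted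
    det-charMat = begin
      det R (s ℕ.* n) (charMat R X lam mu)
        ≈⟨ det-cong (s ℕ.* n) {charMat R X lam mu} {λ r t → untwisted (reorder r) (reorder t)} (≈-byCombine s n charMat-X≈untwisted) ⟩
      det R (s ℕ.* n) (λ r t → untwisted (reorder r) (reorder t))
        ≈⟨ det-reindex (ℕ.*-comm s n) reorder reorder⁻¹ reorder-inverseˡ reorder-inverseʳ untwisted ⟩
      det R (n ℕ.* s) untwisted ∎

    a b : Carrier
    a = (lam + natR R n * mu) - (natR R n - 1#)
    b = (lam + natR R ((m ℕ.+ n) ∸ 1) * mu) - (natR R n - 1#)

    S-shift : ∀ u u′ → S u u′ - natR R n * δ u u′ ≈ arrowhead m b a u u′
    S-shift zero zero = solve 3 (λ l k N → (l :+ k :+ con (+ 1)) :- N :* con (+ 1) := l :+ k :- (N :- con (+ 1)))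
      refl lam (natR R (degree zero) * mu) (natR R n)
    S-shift zero (suc j) = solve 1 (λ N → :- con (+ 1) :- N :* con (+ 0) := :- con (+ 1)) refl (natR R n)
    S-shift (suc i) zero = solve 1 (λ N → :- con (+ 1) :- N :* con (+ 0) := :- con (+ 1)) refl (natR R n)
    S-shift (suc i) (suc j) = solve 4 (λ e l k N → e :* (l :+ k :+ con (+ 1)) :- N :* e := e :* (l :+ k :- (N :- con (+ 1))))
      refl (δ i j) lam (natR R n * mu) (natR R n)

mainTheorem10 : ∀ {c ℓ : Level} (R : CommutativeRing c ℓ) (m n : ℕ) → 1 ≤ m → 1 ≤ n →
    (φ : Voltage (star m) (complete n)) → IsVoltageAssignment (star m) (complete n) φ →
    (lam mu : CommutativeRing.Carrier R) →
    let open CommutativeRing R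
        nat = natR R
        _^_ = _^R_ R
        _-_ = _-R_ R
        a = (lam + (nat n * mu)) - (nat n - 1#)
        b = (lam + (nat ((m ℕ.+ n) ∸ 1) * mu)) - (nat n - 1#)
        c' = (lam + (nat n * mu)) + 1#
        d = (lam + (nat ((m ℕ.+ n) ∸ 1) * mu)) + 1#
    in F R (bundle (star m) (complete n) φ) lam mu
       ≈ ((a ^ (m ∸ 1)) * ((a * b) - nat m))
         * ((c' ^ ((m ∸ 1) ℕ.* (n ∸ 1))) * (((c' * d) - nat m) ^ (n ∸ 1)))
mainTheorem10 R (suc m′) (suc n′) (s≤s z≤n) (s≤s z≤n) φ isVoltage lam mu = begin
  F R X lam mu
    ≈⟨ det-charMat ⟩
  det R (n ℕ.* s) untwisted
    ≈⟨ det-kronecker R n′ s S (δ R) ⟩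
  det R s (λ u u′ → S u u′ - natR R n * δ R u u′) * det R s S ^ n′
    ≈⟨ *-cong (trans (det-cong R s S-shift) (det-arrowhead R m′ b a)) (^-congˡ n′ (det-arrowhead R m′ d c′)) ⟩
  (a ^ m′ * (a * b - natR R m)) * (c′ ^ m′ * (c′ * d - natR R m)) ^ n′
    ≈⟨ *-congˡ (trans (^-distrib-* _ _ n′) (*-congʳ (^-assocʳ c′ m′ n′))) ⟩
  (a ^ m′ * (a * b - natR R m)) * (c′ ^ (m′ ℕ.* n′) * (c′ * d - natR R m) ^ n′)
    ≡⟨ ≡.cong₂ (λ x y → (x * (a * b - natR R m)) * y) (^R≡^ R a m′)
                (≡.cong₂ _*_ (^R≡^ R c′ (m′ ℕ.* n′)) (^R≡^ R (c′ * d - natR R m) n′)) ⟨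
  (_^R_ R a m′ * (a * b - natR R m)) * (_^R_ R c′ (m′ ℕ.* n′) * _^R_ R (c′ * d - natR R m) n′) ∎
  where
  open CommutativeRing R hiding (zero)
  open import Relation.Binary.Reasoning.Setoid setoid
  open import Algebra.Properties.CommutativeSemiring.Exp commutativeSemiring using (_^_; ^-congˡ; ^-distrib-*; ^-assocʳ)
  open StarBundle R m′ n′ φ isVoltage lam mu
  c′ d : Carrier
  c′ = weight (suc zero)
  d = weight zero
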